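{- Let $p$ be a prime with $p \equiv 3 \pmod 4$. Then every pattern of quadratic residues and nonresidues modulo $p$ of length $3$ occurs in $\mathbb{Z}_p$ either exactly $\lfloor \frac{p-3}{8} \rfloor$ times or exactly $\lceil \frac{p-3}{8} \rceil$ times.
   Context: $\mathbb{Z}_p$ denotes the integers modulo $p$. A nonzero $x \in \mathbb{Z}_p$ is a quadratic residue if $x \equiv y^2 \pmod p$ for some $y$, and a nonresidue otherwise. A pattern of length $k$ is a word $w = w_0 \cdots w_{k-1}$ over $\{r, n\}$. An occurrence of $w$ in $\mathbb{Z}_p$ is an $a \in \mathbb{Z}_p$ such that $a, a+1, \dots, a+(k-1)$ (computed in $\mathbb{Z}_p$) are all nonzero and $a+i$ is a quadratic residue if $w_i = r$ and a nonresidue if $w_i = n$, for each $0 \le i \le k-1$. The number of occurrences of $w$ is the number of such $a$. -}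

module Defs where

open import Data.Nat using (ℕ; zero; suc; _+_; _*_; _∸_; _≟_; NonZero)
open import Data.Nat.DivMod using (_%_; _/_)
open import Data.Fin using (Fin; toℕ)
open import Data.Fin.Properties using (any?; all?)
open import Data.Vec using (Vec; lookup)
open import Data.List using (List; length; filter)
open import Data.Fin.Base using ()
open import Data.List.Base using ()
open import Data.Product using (∃; _×_)
open import Relation.Nullary using (¬_; Dec; yes; no)
open import Relation.Nullary.Decidable using (_×-dec_; ¬?)
open import Relation.Binary.PropositionalEquality using (_≡_; _≢_)
import Data.List as L

-- Letters of a pattern: r = quadratic residue, n = nonresidue.
data Letter : Set where
  r n : Letter

Pattern : ℕ → Set
Pattern k = Vec Letter k

module _ (p : ℕ) .{{_ : NonZero p}} where

  NonZeroMod : ℕ → Set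
  NonZeroMod x = x % p ≢ 0

  QR : ℕ → Set
  QR x = NonZeroMod x × ∃ λ (y : Fin p) → (toℕ y * toℕ y) % p ≡ x % p

  QNR : ℕ → Set
  QNR x = NonZeroMod x × ¬ QR x

  QR? : (x : ℕ) → Dec (QR x)
  QR? x = ¬? ((x % p) ≟ 0) ×-dec any? (λ y → ((toℕ y * toℕ y) % p) ≟ (x % p))

  QNR? : (x : ℕ) → Dec (QNR x)
  QNR? x = ¬? ((x % p) ≟ 0) ×-dec ¬? (QR? x)

  Matches : Letter → ℕ → Set
  Matches r x = QR x
  Matches n x = QNR x

  Matches? : (l : Letter) (x : ℕ) → Dec (Matches l x)
  Matches? r x = QR? x
  Matches? n x = QNR? x

  Occurrence : {k : ℕ} → Pattern k → Fin p → Set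
  Occurrence {k} w a = (i : Fin k) → Matches (lookup w i) (toℕ a + toℕ i)

  Occurrence? : {k : ℕ} (w : Pattern k) (a : Fin p) → Dec (Occurrence w a)
  Occurrence? w a = all? (λ i → Matches? (lookup w i) (toℕ a + toℕ i))

  occurrences : {k : ℕ} → Pattern k → ℕ
  occurrences w = length (filter (Occurrence? w) (L.allFin p))

{-# OPTIONS --safe #-}
-- Let χ be the quadratic character mod p and sign r = 1, sign n = −1.  For y ≢ 0 the factor
-- 1 + sign l · χ(y) is 2 or 0 according as y does or does not carry the letter l, so summing
-- ∏ᵢ (1 + sign lᵢ · χ(x + i)) over x gives 8 times the number of occurrences of l₀l₁l₂, up to the
-- three x at which some x + i ≡ 0.  Expanding the product and using ∑ χ = 0 and the Jacobi sums
-- ∑ χ(x) χ(x + c) = −1 (c ≢ 0) leaves 8 N(w) = p − D(w) ± ∑ χ(x) χ(x + 1) χ(x + 2), where D(w)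
-- depends only on w, χ(−1) and χ(2).  If χ(−1) were 1, adding the formulas for rrr and rrn would
-- give 2p ≡ 2 (mod 8), contradicting p ≡ 3 (mod 4).  So χ(−1) = −1, the substitution x ↦ −x − 2
-- shows that the triple sum vanishes, and D(w) ∈ {3, 7, −1} makes 8 N(w) differ from p − 3 by at
-- most 4.  Multiplicativity of χ needs no Euler criterion: multiplying by a nonresidue sends the
-- residues to nonresidues, and as both classes are equally large, also the nonresidues to residues.

module Submission where

open import Defs using (Letter; Pattern; QR; QNR; QR?; QNR?; Matches?; Occurrence?; occurrences)

import Algebra.Properties.Semiring.Sum as SemiringSum
open import Data.Empty using (⊥-elim)
open import Data.Fin.Base as Fin using (Fin; toℕ; fromℕ<)
open import Data.Fin.Permutation using (Permutation; permutation)
import Data.Fin.Properties as Finₚ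
open import Data.Integer.Base as ℤ using (ℤ; 0ℤ; 1ℤ; -1ℤ)
import Data.Integer.Properties as ℤₚ
import Data.Integer.Tactic.RingSolver as ℤ-Solver
import Data.List.Base as List
open import Data.Nat.Base as ℕ using (ℕ; zero; suc; NonZero; z≤n; s≤s; ≢-nonZero)
open import Data.Nat.Coprimality using (coprime-Bézout; prime⇒coprime)
open import Data.Nat.Divisibility using (_∣_; m%n≡0⇒n∣m; n∣m⇒m%n≡0; n∣m*n)
open import Data.Nat.DivMod
  using (_%_; _/_; m%n%n≡m%n; %-distribˡ-+; %-distribˡ-*; m<n⇒m%n≡m; m%n<n; m%n≤m; n%n≡0; m*n%n≡0;
         [m+kn]%n≡m%n; m<n⇒m/n≡0; m*n/n≡m; +-distrib-/-∣ʳ)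
open import Data.Nat.GCD using (module Bézout)
open import Data.Nat.Primality using (Prime; euclidsLemma; prime⇒nonTrivial)
import Data.Nat.Properties as ℕₚ
open ℕₚ using (_≟_)
import Data.Nat.Tactic.RingSolver as ℕ-Solver
open import Data.Product.Base as Product using (Σ; _,_; proj₁; proj₂; _×_)
open import Data.Sum.Base as Sum using (_⊎_; inj₁; inj₂; [_,_]′)
open import Data.Vec.Base using (_∷_; [])
open import Function.Base using (_∘_; id)
open import Level using (0ℓ)
open import Relation.Binary.Bundles using (Setoid)
import Relation.Binary.Construct.On as On
open import Relation.Binary.PropositionalEquality
import Relation.Binary.Reasoning.Setoid as SetoidReasoning
open import Relation.Nullary using (¬_; Dec; yes; no; contradiction)
open import Relation.Nullary.Decidable using (_×-dec_)
open import Relation.Unary using (Decidable)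

open import Algebra.Properties.AbelianGroup ℤₚ.+-0-abelianGroup using () renaming (∙-cancelˡ to +-cancelˡ-ℤ)
open import Algebra.Properties.CommutativeSemigroup ℕₚ.*-commutativeSemigroup
  using () renaming (interchange to *-interchange)

module Congruence (p : ℕ) .{{_ : NonZero p}} where
  open import Data.Nat.Base using (_+_; _*_; _∸_)

  infix 4 _≈_ _≉_ _≈?_
  _≈_ : ℕ → ℕ → Set
  x ≈ y = x % p ≡ y % p

  _≉_ : ℕ → ℕ → Set
  x ≉ y = ¬ x ≈ y

  ≈-setoid : Setoid 0ℓ 0ℓ
  ≈-setoid = On.setoid (setoid ℕ) (_% p)

  open Setoid ≈-setoid public using () renaming (refl to ≈-refl; sym to ≈-sym; trans to ≈-trans)
  module ≈-Reasoning = SetoidReasoning ≈-setoid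

  ≡⇒≈ : ∀ {x y} → x ≡ y → x ≈ y
  ≡⇒≈ = cong (_% p)

  -- For a variable modulus 0 % p does not reduce, so x ≈ 0 and x % p ≡ 0 are different types.
  0%p≡0 : 0 % p ≡ 0
  0%p≡0 = m<n⇒m%n≡m (ℕ.>-nonZero⁻¹ p)

  ≈0⇒%p≡0 : ∀ {x} → x ≈ 0 → x % p ≡ 0
  ≈0⇒%p≡0 x≈0 = trans x≈0 0%p≡0

  %p≡0⇒≈0 : ∀ {x} → x % p ≡ 0 → x ≈ 0
  %p≡0⇒≈0 x%p≡0 = trans x%p≡0 (sym 0%p≡0)

  _≈?_ : ∀ x y → Dec (x ≈ y)
  x ≈? y = x % p ≟ y % p

  ≈0? : ∀ x → Dec (x ≈ 0)
  ≈0? x = x ≈? 0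

  %-≈ : ∀ x → x % p ≈ x
  %-≈ x = m%n%n≡m%n x p

  +-cong : ∀ {a b c d} → a ≈ b → c ≈ d → a + c ≈ b + d
  +-cong {a} {b} {c} {d} a≈b c≈d = begin
    (a + c) % p             ≡⟨ %-distribˡ-+ a c p ⟩
    (a % p + c % p) % p     ≡⟨ cong₂ (λ u v → (u + v) % p) a≈b c≈d ⟩
    (b % p + d % p) % p     ≡⟨ %-distribˡ-+ b d p ⟨
    (b + d) % p             ∎
    where open ≡-Reasoning

  *-cong : ∀ {a b c d} → a ≈ b → c ≈ d → a * c ≈ b * d
  *-cong {a} {b} {c} {d} a≈b c≈d = begin
    (a * c) % p             ≡⟨ %-distribˡ-* a c p ⟩
    (a % p * (c % p)) % p   ≡⟨ cong₂ (λ u v → (u * v) % p) a≈b c≈d ⟩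
    (b % p * (d % p)) % p   ≡⟨ %-distribˡ-* b d p ⟨
    (b * d) % p             ∎
    where open ≡-Reasoning

  +-congˡ : ∀ x {y z} → y ≈ z → x + y ≈ x + z
  +-congˡ x = +-cong {x} ≈-refl

  +-congʳ : ∀ x {y z} → y ≈ z → y + x ≈ z + x
  +-congʳ x y≈z = +-cong y≈z (≈-refl {x})

  *-congˡ : ∀ x {y z} → y ≈ z → x * y ≈ x * z
  *-congˡ x = *-cong {x} ≈-refl

  *-congʳ : ∀ x {y z} → y ≈ z → y * x ≈ z * x
  *-congʳ x y≈z = *-cong y≈z (≈-refl {x})

  *-zeroʳ-≈ : ∀ x {y} → y ≈ 0 → x * y ≈ 0
  *-zeroʳ-≈ x {y} y≈0 = ≈-trans (*-congˡ x y≈0) (≡⇒≈ (ℕₚ.*-zeroʳ x))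

  *-zeroˡ-≈ : ∀ {x} y → x ≈ 0 → x * y ≈ 0
  *-zeroˡ-≈ {x} y x≈0 = ≈-trans (≡⇒≈ (ℕₚ.*-comm x y)) (*-zeroʳ-≈ y x≈0)

  -- Exact subtraction, as x % p < p.
  neg : ℕ → ℕ
  neg x = p ∸ x % p

  neg-cong : ∀ {x y} → x ≈ y → neg x ≈ neg y
  neg-cong x≈y = ≡⇒≈ (cong (p ∸_) x≈y)

  +-inverseʳ : ∀ x → x + neg x ≈ 0
  +-inverseʳ x = begin
    x + neg x           ≈⟨ +-congʳ (neg x) (%-≈ x) ⟨
    x % p + neg x       ≡⟨ ℕₚ.m+[n∸m]≡n (ℕₚ.<⇒≤ (m%n<n x p)) ⟩
    p                   ≈⟨ %p≡0⇒≈0 (n%n≡0 p) ⟩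
    0                   ∎
    where open ≈-Reasoning

  +-inverseˡ : ∀ x → neg x + x ≈ 0
  +-inverseˡ x = ≈-trans (≡⇒≈ (ℕₚ.+-comm (neg x) x)) (+-inverseʳ x)

  +-cancelʳ : ∀ {a b} c → a + c ≈ b + c → a ≈ b
  +-cancelʳ {a} {b} c a+c≈b+c = begin
    a                   ≡⟨ ℕₚ.+-identityʳ a ⟨
    a + 0               ≈⟨ +-congˡ a (+-inverseʳ c) ⟨
    a + (c + neg c)     ≡⟨ ℕₚ.+-assoc a c (neg c) ⟨
    a + c + neg c       ≈⟨ +-congʳ (neg c) a+c≈b+c ⟩
    b + c + neg c       ≡⟨ ℕₚ.+-assoc b c (neg c) ⟩
    b + (c + neg c)     ≈⟨ +-congˡ b (+-inverseʳ c) ⟩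
    b + 0               ≡⟨ ℕₚ.+-identityʳ b ⟩
    b                   ∎
    where open ≈-Reasoning

  +≈0⇒≈neg : ∀ {a} b → a + b ≈ 0 → a ≈ neg b
  +≈0⇒≈neg b a+b≈0 = +-cancelʳ b (≈-trans a+b≈0 (≈-sym (+-inverseˡ b)))

  neg-involutive : ∀ x → neg (neg x) ≈ x
  neg-involutive x = ≈-sym (+≈0⇒≈neg (neg x) (+-inverseʳ x))

  *-distrib-neg : ∀ x y → x * neg y ≈ neg (x * y)
  *-distrib-neg x y = +≈0⇒≈neg (x * y) (begin
    x * neg y + x * y   ≡⟨ ℕₚ.*-distribˡ-+ x (neg y) y ⟨
    x * (neg y + y)     ≈⟨ *-zeroʳ-≈ x (+-inverseˡ y) ⟩
    0                   ∎)
    where open ≈-Reasoning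

  x+m≈0⇒x+[m+k]≈k : ∀ x m k → x + m ≈ 0 → x + (m + k) ≈ k
  x+m≈0⇒x+[m+k]≈k x m k x+m≈0 = ≈-trans (≡⇒≈ (sym (ℕₚ.+-assoc x m k))) (+-congʳ k x+m≈0)

  x+[m+k]≈0⇒x+m≈neg[k] : ∀ x m k → x + (m + k) ≈ 0 → x + m ≈ neg k
  x+[m+k]≈0⇒x+m≈neg[k] x m k x+m+k≈0 = +≈0⇒≈neg k (≈-trans (≡⇒≈ (ℕₚ.+-assoc x m k)) x+m+k≈0)

  neg[x+[m+k]]+k≈neg[x+m] : ∀ x m k → neg (x + (m + k)) + k ≈ neg (x + m)
  neg[x+[m+k]]+k≈neg[x+m] x m k = +≈0⇒≈neg (x + m) (begin
    neg (x + (m + k)) + k + (x + m)   ≡⟨ regroup (neg (x + (m + k))) k x m ⟩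
    neg (x + (m + k)) + (x + (m + k)) ≈⟨ +-inverseˡ (x + (m + k)) ⟩
    0                                 ∎)
    where
    open ≈-Reasoning
    regroup : ∀ n k x m → n + k + (x + m) ≡ n + (x + (m + k))
    regroup = ℕ-Solver.solve-∀

  record Bijection : Set where
    field
      to from       : ℕ → ℕ
      to-cong       : ∀ {x y} → x ≈ y → to x ≈ to y
      from-cong     : ∀ {x y} → x ≈ y → from x ≈ from y
      to∘from       : ∀ x → to (from x) ≈ x
      from∘to       : ∀ x → from (to x) ≈ x

  translation : ℕ → Bijection
  translation c = record
    { to = _+ c ; from = _+ neg c
    ; to-cong = +-congʳ c ; from-cong = +-congʳ (neg c)
    ; to∘from = λ x → cancel x (neg c) c (+-inverseˡ c)
    ; from∘to = λ x → cancel x c (neg c) (+-inverseʳ c)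
    }
    where
    cancel : ∀ x a b → a + b ≈ 0 → x + a + b ≈ x
    cancel x a b a+b≈0 = begin
      x + a + b     ≡⟨ ℕₚ.+-assoc x a b ⟩
      x + (a + b)   ≈⟨ +-congˡ x a+b≈0 ⟩
      x + 0         ≡⟨ ℕₚ.+-identityʳ x ⟩
      x             ∎
      where open ≈-Reasoning

  reflection : ℕ → Bijection
  reflection c = record
    { to = reflect ; from = reflect
    ; to-cong = reflect-cong ; from-cong = reflect-cong
    ; to∘from = reflect-involutive ; from∘to = reflect-involutive
    }
    where
    reflect : ℕ → ℕ
    reflect x = neg (x + c)

    reflect-cong : ∀ {x y} → x ≈ y → reflect x ≈ reflect y
    reflect-cong x≈y = neg-cong (+-congʳ c x≈y)

    reflect-involutive : ∀ x → reflect (reflect x) ≈ x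
    reflect-involutive x = ≈-sym (+≈0⇒≈neg (reflect x + c) (begin
      x + (reflect x + c)   ≡⟨ swap x (reflect x) c ⟩
      (x + c) + reflect x   ≈⟨ +-inverseʳ (x + c) ⟩
      0                     ∎))
      where
      open ≈-Reasoning
      swap : ∀ x y z → x + (y + z) ≡ (x + z) + y
      swap = ℕ-Solver.solve-∀

module PrimeModulus (p : ℕ) .{{_ : NonZero p}} (p-prime : Prime p) where
  open import Data.Nat.Base using (_+_; _*_)
  open Congruence p public

  1≉0 : 1 ≉ 0
  1≉0 1≈0 with trans (sym (m<n⇒m%n≡m (ℕ.nonTrivial⇒n>1 p {{prime⇒nonTrivial p-prime}}))) (≈0⇒%p≡0 1≈0)
  ... | ()

  *≈0⇒≈0 : ∀ x y → x * y ≈ 0 → x ≈ 0 ⊎ y ≈ 0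
  *≈0⇒≈0 x y xy≈0 = Sum.map ∣⇒≈0 ∣⇒≈0 (euclidsLemma x y p-prime (m%n≡0⇒n∣m (x * y) p (≈0⇒%p≡0 xy≈0)))
    where
    ∣⇒≈0 : ∀ {z} → p ∣ z → z ≈ 0
    ∣⇒≈0 {z} p∣z = %p≡0⇒≈0 (n∣m⇒m%n≡0 z p p∣z)

  *-≉0 : ∀ {x y} → x ≉ 0 → y ≉ 0 → x * y ≉ 0
  *-≉0 {x} {y} x≉0 y≉0 xy≈0 = [ x≉0 , y≉0 ]′ (*≈0⇒≈0 x y xy≈0)

  inverse : ∀ x → x ≉ 0 → Σ ℕ λ y → x * y ≈ 1
  inverse x x≉0 with coprime-Bézout (prime⇒coprime p-prime {{≢-nonZero (x≉0 ∘ %p≡0⇒≈0)}} (m%n<n x p))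
  ... | Bézout.-+ a b 1+ap≡bx = b , (begin
    x * b               ≈⟨ *-congʳ b (%-≈ x) ⟨
    x % p * b           ≡⟨ ℕₚ.*-comm (x % p) b ⟩
    b * (x % p)         ≡⟨ 1+ap≡bx ⟨
    1 + a * p           ≈⟨ [m+kn]%n≡m%n 1 a p ⟩
    1                   ∎)
    where open ≈-Reasoning
  ... | Bézout.+- a b 1+bx≡ap = neg b , ≈-trans (*-distrib-neg x b) (≈-trans (neg-cong xb≈neg[1]) (neg-involutive 1))
    where
    xb≈neg[1] : x * b ≈ neg 1
    xb≈neg[1] = +≈0⇒≈neg 1 (begin
      x * b + 1         ≈⟨ +-congʳ 1 (*-congʳ b (%-≈ x)) ⟨
      x % p * b + 1     ≡⟨ ℕₚ.+-comm (x % p * b) 1 ⟩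
      1 + x % p * b     ≡⟨ cong (1 +_) (ℕₚ.*-comm (x % p) b) ⟩
      1 + b * (x % p)   ≡⟨ 1+bx≡ap ⟩
      a * p             ≈⟨ %p≡0⇒≈0 (m*n%n≡0 a p) ⟩
      0                 ∎)
      where open ≈-Reasoning

  -- Junk value inv 0 = 0, which keeps inv total and involutive.
  inv : ℕ → ℕ
  inv x with x % p ≟ 0
  ... | yes _   = 0
  ... | no x≢0  = proj₁ (inverse x (x≢0 ∘ ≈0⇒%p≡0))

  *-inverseʳ : ∀ {x} → x ≉ 0 → x * inv x ≈ 1
  *-inverseʳ {x} x≉0 with x % p ≟ 0
  ... | yes x%p≡0 = ⊥-elim (x≉0 (%p≡0⇒≈0 x%p≡0))
  ... | no x≢0    = proj₂ (inverse x (x≢0 ∘ ≈0⇒%p≡0))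

  *-inverseˡ : ∀ {x} → x ≉ 0 → inv x * x ≈ 1
  *-inverseˡ {x} x≉0 = ≈-trans (≡⇒≈ (ℕₚ.*-comm (inv x) x)) (*-inverseʳ x≉0)

  inv-≈0 : ∀ {x} → x ≈ 0 → inv x ≡ 0
  inv-≈0 {x} x≈0 with x % p ≟ 0
  ... | yes _   = refl
  ... | no x≢0  = ⊥-elim (x≢0 (≈0⇒%p≡0 x≈0))

  inverse-unique : ∀ x {y z} → x * y ≈ 1 → x * z ≈ 1 → y ≈ z
  inverse-unique x {y} {z} xy≈1 xz≈1 = begin
    y             ≡⟨ ℕₚ.*-identityʳ y ⟨
    y * 1         ≈⟨ *-congˡ y xz≈1 ⟨
    y * (x * z)   ≡⟨ ℕₚ.*-assoc y x z ⟨
    (y * x) * z   ≡⟨ cong (_* z) (ℕₚ.*-comm y x) ⟩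
    (x * y) * z   ≈⟨ *-congʳ z xy≈1 ⟩
    1 * z         ≡⟨ ℕₚ.*-identityˡ z ⟩
    z             ∎
    where open ≈-Reasoning

  inv-≉0 : ∀ {x} → x ≉ 0 → inv x ≉ 0
  inv-≉0 {x} x≉0 inv[x]≈0 = 1≉0 (≈-trans (≈-sym (*-inverseʳ x≉0)) (*-zeroʳ-≈ x inv[x]≈0))

  inv-cong : ∀ {x y} → x ≈ y → inv x ≈ inv y
  inv-cong {x} {y} x≈y with ≈0? x
  ... | yes x≈0 = ≡⇒≈ (trans (inv-≈0 x≈0) (sym (inv-≈0 (≈-trans (≈-sym x≈y) x≈0))))
  ... | no x≉0  = inverse-unique x (*-inverseʳ x≉0) (≈-trans (*-congʳ (inv y) x≈y) (*-inverseʳ (x≉0 ∘ ≈-trans x≈y)))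

  inv-involutive : ∀ x → inv (inv x) ≈ x
  inv-involutive x with ≈0? x
  ... | yes x≈0 = ≈-trans (≡⇒≈ (trans (cong inv (inv-≈0 x≈0)) (inv-≈0 ≈-refl))) (≈-sym x≈0)
  ... | no x≉0  = inverse-unique (inv x) (*-inverseʳ (inv-≉0 x≉0)) (*-inverseˡ x≉0)

  scaling : ∀ a → a ≉ 0 → Bijection
  scaling a a≉0 = record
    { to = a *_ ; from = inv a *_
    ; to-cong = *-congˡ a ; from-cong = *-congˡ (inv a)
    ; to∘from = λ x → cancel a (inv a) x (*-inverseʳ a≉0)
    ; from∘to = λ x → cancel (inv a) a x (*-inverseˡ a≉0)
    }
    where
    cancel : ∀ u v x → u * v ≈ 1 → u * (v * x) ≈ x
    cancel u v x uv≈1 = begin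
      u * (v * x)   ≡⟨ ℕₚ.*-assoc u v x ⟨
      u * v * x     ≈⟨ *-congʳ x uv≈1 ⟩
      1 * x         ≡⟨ ℕₚ.*-identityˡ x ⟩
      x             ∎
      where open ≈-Reasoning

  inversion : Bijection
  inversion = record
    { to = inv ; from = inv ; to-cong = inv-cong ; from-cong = inv-cong
    ; to∘from = inv-involutive ; from∘to = inv-involutive }

𝟙 : ∀ {a} {A : Set a} → Dec A → ℤ
𝟙 (yes _) = 1ℤ
𝟙 (no _)  = 0ℤ

𝟙-yes : ∀ {a} {A : Set a} (A? : Dec A) → A → 𝟙 A? ≡ 1ℤ
𝟙-yes (yes _) _  = refl
𝟙-yes (no ¬a) a  = ⊥-elim (¬a a)

𝟙-no : ∀ {a} {A : Set a} (A? : Dec A) → ¬ A → 𝟙 A? ≡ 0ℤ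
𝟙-no (yes a) ¬a = ⊥-elim (¬a a)
𝟙-no (no _)  _  = refl

𝟙-cong : ∀ {a b} {A : Set a} {B : Set b} (A? : Dec A) (B? : Dec B) → (A → B) → (B → A) → 𝟙 A? ≡ 𝟙 B?
𝟙-cong (yes _) (yes _) _ _  = refl
𝟙-cong (no _)  (no _)  _ _  = refl
𝟙-cong (yes a) (no ¬b) f _  = ⊥-elim (¬b (f a))
𝟙-cong (no ¬a) (yes b) _ g  = ⊥-elim (¬a (g b))

𝟙≡0⇒¬ : ∀ {a} {A : Set a} (A? : Dec A) → 𝟙 A? ≡ 0ℤ → ¬ A
𝟙≡0⇒¬ (no ¬a) _ = ¬a

𝟙-×-dec : ∀ {a b} {A : Set a} {B : Set b} (A? : Dec A) (B? : Dec B) → 𝟙 (A? ×-dec B?) ≡ 𝟙 A? ℤ.* 𝟙 B?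
𝟙-×-dec (yes _) (yes _) = refl
𝟙-×-dec (yes _) (no _)  = refl
𝟙-×-dec (no _)  _       = refl

𝟙-nonneg : ∀ {a} {A : Set a} (A? : Dec A) → 0ℤ ℤ.≤ 𝟙 A?
𝟙-nonneg (yes _) = ℤ.+≤+ z≤n
𝟙-nonneg (no _)  = ℤ.+≤+ z≤n

i≡-i⇒i≡0 : ∀ {i} → i ≡ ℤ.- i → i ≡ 0ℤ
i≡-i⇒i≡0 {ℤ.+ zero}    _  = refl
i≡-i⇒i≡0 {ℤ.+[1+ _ ]}  ()
i≡-i⇒i≡0 {ℤ.-[1+ _ ]}  ()

module FinSum where
  open import Data.Integer.Base using (+_; _+_; _*_)
  open SemiringSum ℤₚ.+-*-semiring public using (sum)

  sum-const : ∀ n c → sum {n} (λ _ → c) ≡ + n * c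
  sum-const zero    c = sym (ℤₚ.*-zeroˡ c)
  sum-const (suc n) c = begin
    c + sum {n} (λ _ → c)   ≡⟨ cong (λ s → c + s) (sum-const n c) ⟩
    c + + n * c             ≡⟨ cong (_+ + n * c) (ℤₚ.*-identityˡ c) ⟨
    1ℤ * c + + n * c        ≡⟨ ℤₚ.*-distribʳ-+ c 1ℤ (+ n) ⟨
    (1ℤ + + n) * c          ∎
    where open ≡-Reasoning

  sum-zero : ∀ {n} (f : Fin n → ℤ) → (∀ i → f i ≡ 0ℤ) → sum f ≡ 0ℤ
  sum-zero {zero}  f _   = refl
  sum-zero {suc n} f f≡0 = cong₂ _+_ (f≡0 Fin.zero) (sum-zero (f ∘ Fin.suc) (f≡0 ∘ Fin.suc))

  sum-single-support : ∀ {n} (f : Fin n → ℤ) i → (∀ j → j ≢ i → f j ≡ 0ℤ) → sum f ≡ f i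
  sum-single-support f Fin.zero vanish = begin
    f Fin.zero + sum (f ∘ Fin.suc)   ≡⟨ cong (λ s → f Fin.zero + s) (sum-zero (f ∘ Fin.suc) (λ j → vanish (Fin.suc j) λ ())) ⟩
    f Fin.zero + 0ℤ                  ≡⟨ ℤₚ.+-identityʳ (f Fin.zero) ⟩
    f Fin.zero                       ∎
    where open ≡-Reasoning
  sum-single-support f (Fin.suc i) vanish = begin
    f Fin.zero + sum (f ∘ Fin.suc)   ≡⟨ cong (_+ sum (f ∘ Fin.suc)) (vanish Fin.zero λ ()) ⟩
    0ℤ + sum (f ∘ Fin.suc)           ≡⟨ ℤₚ.+-identityˡ _ ⟩
    sum (f ∘ Fin.suc)                ≡⟨ sum-single-support (f ∘ Fin.suc) i (λ j j≢i → vanish (Fin.suc j) (j≢i ∘ Finₚ.suc-injective)) ⟩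
    f (Fin.suc i)                    ∎
    where open ≡-Reasoning

  sum-nonneg : ∀ {n} (f : Fin n → ℤ) → (∀ i → 0ℤ ℤ.≤ f i) → 0ℤ ℤ.≤ sum f
  sum-nonneg {zero}  f _   = ℤ.+≤+ z≤n
  sum-nonneg {suc n} f f≥0 = ℤₚ.+-mono-≤ (f≥0 Fin.zero) (sum-nonneg (f ∘ Fin.suc) (f≥0 ∘ Fin.suc))

  nonneg-+≡0 : ∀ {a b} → 0ℤ ℤ.≤ a → 0ℤ ℤ.≤ b → a + b ≡ 0ℤ → a ≡ 0ℤ × b ≡ 0ℤ
  nonneg-+≡0 {+ zero}  {+ zero}  _ _ _  = refl , refl
  nonneg-+≡0 {+ zero}  {+ suc _} _ _ ()
  nonneg-+≡0 {+ suc _} {+ _}     _ _ ()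

  sum-nonneg≡0⇒≡0 : ∀ {n} (f : Fin n → ℤ) → (∀ i → 0ℤ ℤ.≤ f i) → sum f ≡ 0ℤ → ∀ i → f i ≡ 0ℤ
  sum-nonneg≡0⇒≡0 {suc n} f f≥0 sum≡0 i
    with nonneg-+≡0 (f≥0 Fin.zero) (sum-nonneg (f ∘ Fin.suc) (f≥0 ∘ Fin.suc)) sum≡0
  ... | f0≡0 , rest≡0 with i
  ...   | Fin.zero  = f0≡0
  ...   | Fin.suc j = sum-nonneg≡0⇒≡0 (f ∘ Fin.suc) (f≥0 ∘ Fin.suc) rest≡0 j

  length-filter-tabulate : ∀ {A : Set} {P : A → Set} (P? : Decidable P) {n} (f : Fin n → A) →
                           + List.length (List.filter P? (List.tabulate f)) ≡ sum (λ i → 𝟙 (P? (f i)))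
  length-filter-tabulate P? {zero}  f = refl
  length-filter-tabulate P? {suc n} f with P? (f Fin.zero)
  ... | yes _ = cong (λ s → 1ℤ + s) (length-filter-tabulate P? (f ∘ Fin.suc))
  ... | no _  = trans (length-filter-tabulate P? (f ∘ Fin.suc)) (sym (ℤₚ.+-identityˡ _))

module ResidueSums (p : ℕ) .{{_ : NonZero p}} where
  open import Data.Integer.Base using (+_; -_; _+_; _-_; _*_)
  open Congruence p
  open FinSum
  open SemiringSum ℤₚ.+-*-semiring using (∑-distrib-+; ∑-comm; sum-permute; sum-cong-≗; *-distribˡ-sum)

  ∑ : (ℕ → ℤ) → ℤ
  ∑ f = sum {p} (λ i → f (toℕ i))

  WellDefined : (ℕ → ℤ) → Set
  WellDefined f = ∀ {x y} → x ≈ y → f x ≡ f y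

  toFin : ℕ → Fin p
  toFin x = fromℕ< (m%n<n x p)

  toℕ-toFin : ∀ x → toℕ (toFin x) ≈ x
  toℕ-toFin x = trans (cong (_% p) (Finₚ.toℕ-fromℕ< (m%n<n x p))) (%-≈ x)

  toFin-toℕ : ∀ i → toFin (toℕ i) ≡ i
  toFin-toℕ i = Finₚ.toℕ-injective (trans (Finₚ.toℕ-fromℕ< _) (m<n⇒m%n≡m (Finₚ.toℕ<n i)))

  ∑-cong : ∀ {f g} → (∀ x → f x ≡ g x) → ∑ f ≡ ∑ g
  ∑-cong f≗g = sum-cong-≗ {p} (f≗g ∘ toℕ)

  ∑-+ : ∀ f g → ∑ (λ x → f x + g x) ≡ ∑ f + ∑ g
  ∑-+ f g = ∑-distrib-+ {p} (f ∘ toℕ) (g ∘ toℕ)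

  ∑-*ˡ : ∀ c f → ∑ (λ x → c * f x) ≡ c * ∑ f
  ∑-*ˡ c f = sym (*-distribˡ-sum {p} c (f ∘ toℕ))

  ∑-neg : ∀ f → ∑ (λ x → - f x) ≡ - ∑ f
  ∑-neg f = begin
    ∑ (λ x → - f x)       ≡⟨ ∑-cong (λ x → ℤₚ.-1*i≡-i (f x)) ⟨
    ∑ (λ x → -1ℤ * f x)   ≡⟨ ∑-*ˡ -1ℤ f ⟩
    -1ℤ * ∑ f             ≡⟨ ℤₚ.-1*i≡-i (∑ f) ⟩
    - ∑ f                 ∎
    where open ≡-Reasoning

  ∑-const : ∀ c → ∑ (λ _ → c) ≡ + p * c
  ∑-const = sum-const p

  ∑-swap : ∀ (f : ℕ → ℕ → ℤ) → ∑ (λ x → ∑ (f x)) ≡ ∑ (λ y → ∑ (λ x → f x y))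
  ∑-swap f = ∑-comm {p} {p} (λ i j → f (toℕ i) (toℕ j))

  toFin-cong : ∀ {x y} → x ≈ y → toFin x ≡ toFin y
  toFin-cong x≈y = Finₚ.toℕ-injective (trans (Finₚ.toℕ-fromℕ< _) (trans x≈y (sym (Finₚ.toℕ-fromℕ< _))))

  ∑-reindex : ∀ (b : Bijection) {f} → WellDefined f → ∑ (f ∘ Bijection.to b) ≡ ∑ f
  ∑-reindex b {f} f-wd = begin
    ∑ (f ∘ to)                                ≡⟨ sum-permute (f ∘ to ∘ toℕ) π ⟩
    sum {p} (λ i → f (to (toℕ (toFin (from (toℕ i))))))  ≡⟨ sum-cong-≗ {p} (λ i → f-wd (round-trip to from to-cong to∘from i)) ⟩
    ∑ f                                        ∎
    where
    open Bijection b
    open ≡-Reasoning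
    round-trip : ∀ g h → (∀ {x y} → x ≈ y → g x ≈ g y) → (∀ x → g (h x) ≈ x) → ∀ i → g (toℕ (toFin (h (toℕ i)))) ≈ toℕ i
    round-trip g h g-cong g∘h≈id i = ≈-trans (g-cong (toℕ-toFin (h (toℕ i)))) (g∘h≈id (toℕ i))
    π : Permutation p p
    π = permutation (λ i → toFin (from (toℕ i))) (λ i → toFin (to (toℕ i)))
          (λ i → trans (toFin-cong (round-trip from to from-cong from∘to i)) (toFin-toℕ i))
          (λ i → trans (toFin-cong (round-trip to from to-cong to∘from i)) (toFin-toℕ i))

  ∑-*-+ : ∀ c f g → ∑ (λ x → c * f x + g x) ≡ c * ∑ f + ∑ g
  ∑-*-+ c f g = trans (∑-+ (λ x → c * f x) g) (cong (_+ ∑ g) (∑-*ˡ c f))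

  ∑-expand₃ : ∀ a b c (A B C : ℕ → ℤ) →
              ∑ (λ x → (1ℤ + a * A x) * (1ℤ + b * B x) * (1ℤ + c * C x))
                ≡ ∑ (λ _ → 1ℤ) + (a * ∑ A + (b * ∑ B + (c * ∑ C + (a * b * ∑ (λ x → A x * B x)
                    + (a * c * ∑ (λ x → A x * C x) + (b * c * ∑ (λ x → B x * C x) + a * b * c * ∑ (λ x → A x * B x * C x)))))))
  ∑-expand₃ a b c A B C = begin
    ∑ (λ x → (1ℤ + a * A x) * (1ℤ + b * B x) * (1ℤ + c * C x))
      ≡⟨ ∑-cong (λ x → expand a b c (A x) (B x) (C x)) ⟩
    ∑ (λ x → 1ℤ + r₁ x)
      ≡⟨ trans (∑-+ (λ _ → 1ℤ) r₁)  (cong (λ s → ∑ (λ _ → 1ℤ) + s)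
         (trans (∑-*-+ a A r₂)        (cong (λ s → a * ∑ A + s)
         (trans (∑-*-+ b B r₃)        (cong (λ s → b * ∑ B + s)
         (trans (∑-*-+ c C r₄)        (cong (λ s → c * ∑ C + s)
         (trans (∑-*-+ (a * b) AB r₅) (cong (λ s → a * b * ∑ AB + s)
         (trans (∑-*-+ (a * c) AC r₆) (cong (λ s → a * c * ∑ AC + s)
         (trans (∑-*-+ (b * c) BC r₇) (cong (λ s → b * c * ∑ BC + s)
         (∑-*ˡ (a * b * c) ABC)))))))))))))) ⟩
    ∑ (λ _ → 1ℤ) + (a * ∑ A + (b * ∑ B + (c * ∑ C + (a * b * ∑ AB + (a * c * ∑ AC + (b * c * ∑ BC + a * b * c * ∑ ABC))))))
      ∎
    where
    open ≡-Reasoning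
    AB AC BC ABC r₁ r₂ r₃ r₄ r₅ r₆ r₇ : ℕ → ℤ
    AB x  = A x * B x
    AC x  = A x * C x
    BC x  = B x * C x
    ABC x = A x * B x * C x
    r₇ x  = a * b * c * ABC x
    r₆ x  = b * c * BC x + r₇ x
    r₅ x  = a * c * AC x + r₆ x
    r₄ x  = a * b * AB x + r₅ x
    r₃ x  = c * C x + r₄ x
    r₂ x  = b * B x + r₃ x
    r₁ x  = a * A x + r₂ x
    expand : ∀ a b c A B C → (1ℤ + a * A) * (1ℤ + b * B) * (1ℤ + c * C)
             ≡ 1ℤ + (a * A + (b * B + (c * C + (a * b * (A * B) + (a * c * (A * C) + (b * c * (B * C) + a * b * c * (A * B * C)))))))
    expand = ℤ-Solver.solve-∀

  ∑-product₃ : ∀ a b c (A B C : ℕ → ℤ) → ∑ A ≡ 0ℤ → ∑ B ≡ 0ℤ → ∑ C ≡ 0ℤ →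
               ∑ (λ x → A x * B x) ≡ -1ℤ → ∑ (λ x → A x * C x) ≡ -1ℤ → ∑ (λ x → B x * C x) ≡ -1ℤ →
               ∑ (λ x → (1ℤ + a * A x) * (1ℤ + b * B x) * (1ℤ + c * C x))
                 ≡ + p - (a * b + a * c + b * c) + a * b * c * ∑ (λ x → A x * B x * C x)
  ∑-product₃ a b c A B C ∑A ∑B ∑C ∑AB ∑AC ∑BC = begin
    ∑ (λ x → (1ℤ + a * A x) * (1ℤ + b * B x) * (1ℤ + c * C x))
      ≡⟨ ∑-expand₃ a b c A B C ⟩
    ∑ (λ _ → 1ℤ) + (a * ∑ A + (b * ∑ B + (c * ∑ C + (a * b * ∑ (λ x → A x * B x)
      + (a * c * ∑ (λ x → A x * C x) + (b * c * ∑ (λ x → B x * C x) + a * b * c * X))))))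
      ≡⟨ cong₂ _+_ (∑-const 1ℤ) (cong₂ _+_ (cong (a *_) ∑A) (cong₂ _+_ (cong (b *_) ∑B) (cong₂ _+_ (cong (c *_) ∑C)
           (cong₂ _+_ (cong (a * b *_) ∑AB) (cong₂ _+_ (cong (a * c *_) ∑AC) (cong (λ s → b * c * s + a * b * c * X) ∑BC)))))) ⟩
    + p * 1ℤ + (a * 0ℤ + (b * 0ℤ + (c * 0ℤ + (a * b * -1ℤ + (a * c * -1ℤ + (b * c * -1ℤ + a * b * c * X))))))
      ≡⟨ collect (+ p) a b c X ⟩
    + p - (a * b + a * c + b * c) + a * b * c * X
      ∎
    where
    open ≡-Reasoning
    X = ∑ (λ x → A x * B x * C x)
    collect : ∀ P a b c X → P * 1ℤ + (a * 0ℤ + (b * 0ℤ + (c * 0ℤ + (a * b * -1ℤ + (a * c * -1ℤ + (b * c * -1ℤ + a * b * c * X))))))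
              ≡ P - (a * b + a * c + b * c) + a * b * c * X
    collect = ℤ-Solver.solve-∀

  ∑-nonneg≡0⇒≡0 : ∀ {f} → WellDefined f → (∀ x → 0ℤ ℤ.≤ f x) → ∑ f ≡ 0ℤ → ∀ x → f x ≡ 0ℤ
  ∑-nonneg≡0⇒≡0 {f} f-wd f≥0 ∑f≡0 x =
    trans (f-wd (≈-sym (toℕ-toFin x))) (sum-nonneg≡0⇒≡0 (f ∘ toℕ) (f≥0 ∘ toℕ) ∑f≡0 (toFin x))

  δ : ℕ → ℕ → ℤ
  δ c x = 𝟙 (x ≈? c)

  δ-wellDefined : ∀ c → WellDefined (δ c)
  δ-wellDefined c x≈y = cong (λ r → 𝟙 (r ≟ c % p)) x≈y

  δ-≈ : ∀ {c x} → x ≈ c → δ c x ≡ 1ℤ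
  δ-≈ {c} {x} = 𝟙-yes (x ≈? c)

  δ-≉ : ∀ {c x} → x ≉ c → δ c x ≡ 0ℤ
  δ-≉ {c} {x} = 𝟙-no (x ≈? c)

  δ-sym : ∀ c x → δ c x ≡ δ x c
  δ-sym c x = 𝟙-cong (x ≈? c) (c ≈? x) sym sym

  ∑-δ : ∀ c → ∑ (δ c) ≡ 1ℤ
  ∑-δ c = trans (sum-single-support (δ c ∘ toℕ) (toFin c) vanish) (δ-≈ (toℕ-toFin c))
    where
    vanish : ∀ i → i ≢ toFin c → δ c (toℕ i) ≡ 0ℤ
    vanish i i≢c = δ-≉ λ i≈c → i≢c (trans (sym (toFin-toℕ i)) (toFin-cong i≈c))

module OddPrimeModulus (p : ℕ) .{{_ : NonZero p}} (p-prime : Prime p) (2<p : 2 ℕ.< p) where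
  open import Data.Nat.Base using (_+_; _*_)
  open PrimeModulus p p-prime public

  2≉0 : 2 ≉ 0
  2≉0 2≈0 with trans (sym (m<n⇒m%n≡m 2<p)) (≈0⇒%p≡0 2≈0)
  ... | ()

  ≉neg : ∀ {y} → y ≉ 0 → y ≉ neg y
  ≉neg {y} y≉0 y≈neg[y] = [ 2≉0 , y≉0 ]′ (*≈0⇒≈0 2 y (begin
    2 * y         ≡⟨ cong (y +_) (ℕₚ.+-identityʳ y) ⟩
    y + y         ≈⟨ +-congˡ y y≈neg[y] ⟩
    y + neg y     ≈⟨ +-inverseʳ y ⟩
    0             ∎))
    where open ≈-Reasoning

  neg-square : ∀ z → neg z * neg z ≈ z * z
  neg-square z = begin
    neg z * neg z       ≈⟨ *-distrib-neg (neg z) z ⟩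
    neg (neg z * z)     ≡⟨ cong neg (ℕₚ.*-comm (neg z) z) ⟩
    neg (z * neg z)     ≈⟨ neg-cong (*-distrib-neg z z) ⟩
    neg (neg (z * z))   ≈⟨ neg-involutive (z * z) ⟩
    z * z               ∎
    where open ≈-Reasoning

  square-roots : ∀ y z → y * y ≈ z * z → y ≈ z ⊎ y ≈ neg z
  square-roots y z y²≈z² = Sum.swap (Sum.map (+≈0⇒≈neg z) y≈z (*≈0⇒≈0 (y + z) (y + neg z) product≈0))
    where
    y≈z : y + neg z ≈ 0 → y ≈ z
    y≈z y-z≈0 = ≈-trans (+≈0⇒≈neg (neg z) y-z≈0) (neg-involutive z)
    expand : ∀ y z n → (y + z) * (y + n) + z * z ≡ y * y + (y * (z + n) + z * (z + n))
    expand = ℕ-Solver.solve-∀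
    product≈0 : (y + z) * (y + neg z) ≈ 0
    product≈0 = +-cancelʳ (z * z) (begin
      (y + z) * (y + neg z) + z * z                     ≡⟨ expand y z (neg z) ⟩
      y * y + (y * (z + neg z) + z * (z + neg z))       ≈⟨ +-congˡ (y * y) (+-cong (*-zeroʳ-≈ y (+-inverseʳ z)) (*-zeroʳ-≈ z (+-inverseʳ z))) ⟩
      y * y + 0                                         ≡⟨ ℕₚ.+-identityʳ (y * y) ⟩
      y * y                                             ≈⟨ y²≈z² ⟩
      z * z                                             ≡⟨ ℕₚ.+-identityˡ (z * z) ⟨
      0 + z * z                                         ∎)
      where open ≈-Reasoning

module QuadraticCharacter (p : ℕ) .{{_ : NonZero p}} (p-prime : Prime p) (2<p : 2 ℕ.< p) where
  open import Data.Integer.Base using (+_; -_; _+_; _-_; _*_)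
  open import Algebra.Properties.AbelianGroup ℤₚ.+-0-abelianGroup using (x∙y⁻¹≈ε⇒x≈y)
  open OddPrimeModulus p p-prime 2<p public
  open ResidueSums p public

  QR-≉0 : ∀ {x} → QR p x → x ≉ 0
  QR-≉0 (x≢0 , _) = x≢0 ∘ ≈0⇒%p≡0

  QR-resp : ∀ {x y} → x ≈ y → QR p x → QR p y
  QR-resp x≈y (x≢0 , y , y²≈x) = (x≢0 ∘ trans x≈y) , y , trans y²≈x x≈y

  square⇒QR : ∀ {x} z → x ≉ 0 → z ℕ.* z ≈ x → QR p x
  square⇒QR {x} z x≉0 z²≈x = x≉0 ∘ %p≡0⇒≈0 , toFin z , ≈-trans (*-cong (toℕ-toFin z) (toℕ-toFin z)) z²≈x

  QR-* : ∀ {x y} → QR p x → QR p y → QR p (x ℕ.* y)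
  QR-* qx@(_ , u , u²≈x) qy@(_ , v , v²≈y) =
    square⇒QR (toℕ u ℕ.* toℕ v) (*-≉0 (QR-≉0 qx) (QR-≉0 qy)) (≈-trans (≡⇒≈ (*-interchange (toℕ u) (toℕ v) (toℕ u) (toℕ v))) (*-cong u²≈x v²≈y))

  QR-*-cancelˡ : ∀ {a x} → QR p a → x ≉ 0 → QR p (a ℕ.* x) → QR p x
  QR-*-cancelˡ {a} {x} qa@(_ , u , u²≈a) x≉0 (_ , v , v²≈ax) = square⇒QR (i ℕ.* toℕ v) x≉0 (begin
    (i ℕ.* toℕ v) ℕ.* (i ℕ.* toℕ v)        ≡⟨ *-interchange i (toℕ v) i (toℕ v) ⟩
    (i ℕ.* i) ℕ.* (toℕ v ℕ.* toℕ v)        ≈⟨ *-congˡ (i ℕ.* i) (≈-trans v²≈ax (*-congʳ x (≈-sym u²≈a))) ⟩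
    (i ℕ.* i) ℕ.* ((toℕ u ℕ.* toℕ u) ℕ.* x) ≡⟨ regroup i (toℕ u) x ⟩
    ((toℕ u ℕ.* i) ℕ.* (toℕ u ℕ.* i)) ℕ.* x ≈⟨ *-congʳ x (*-cong u·i≈1 u·i≈1) ⟩
    1 ℕ.* x                                ≡⟨ ℕₚ.*-identityˡ x ⟩
    x                                      ∎)
    where
    open ≈-Reasoning
    i = inv (toℕ u)
    u·i≈1 : toℕ u ℕ.* i ≈ 1
    u·i≈1 = *-inverseʳ (λ u≈0 → QR-≉0 qa (≈-trans (≈-sym u²≈a) (*-zeroʳ-≈ (toℕ u) u≈0)))
    regroup : ∀ i u x → (i ℕ.* i) ℕ.* ((u ℕ.* u) ℕ.* x) ≡ ((u ℕ.* i) ℕ.* (u ℕ.* i)) ℕ.* x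
    regroup = ℕ-Solver.solve-∀

  ≉0-¬QR⇒QNR : ∀ {x} → x ≉ 0 → ¬ QR p x → QNR p x
  ≉0-¬QR⇒QNR x≉0 ¬qx = x≉0 ∘ %p≡0⇒≈0 , ¬qx

  QNR-≉0 : ∀ {x} → QNR p x → x ≉ 0
  QNR-≉0 (x≢0 , _) = x≢0 ∘ ≈0⇒%p≡0

  data Residuosity (x : ℕ) : Set where
    vanishing  : x ≈ 0 → Residuosity x
    residue    : QR p x → Residuosity x
    nonresidue : QNR p x → Residuosity x

  residuosity : ∀ x → Residuosity x
  residuosity x with QR? p x | ≈0? x
  ... | yes qx  | _        = residue qx
  ... | no ¬qx  | yes x≈0  = vanishing x≈0
  ... | no ¬qx  | no x≉0   = nonresidue (≉0-¬QR⇒QNR x≉0 ¬qx)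

  χ : ℕ → ℤ
  χ x with residuosity x
  ... | vanishing _  = 0ℤ
  ... | residue _    = 1ℤ
  ... | nonresidue _ = -1ℤ

  χ-≈0 : ∀ {x} → x ≈ 0 → χ x ≡ 0ℤ
  χ-≈0 {x} x≈0 with residuosity x
  ... | vanishing _   = refl
  ... | residue qx    = ⊥-elim (QR-≉0 qx x≈0)
  ... | nonresidue nx = ⊥-elim (QNR-≉0 nx x≈0)

  χ-QR : ∀ {x} → QR p x → χ x ≡ 1ℤ
  χ-QR {x} qx with residuosity x
  ... | vanishing x≈0      = ⊥-elim (QR-≉0 qx x≈0)
  ... | residue _          = refl
  ... | nonresidue (_ , ¬qx) = ⊥-elim (¬qx qx)

  χ-QNR : ∀ {x} → QNR p x → χ x ≡ -1ℤ
  χ-QNR {x} nx@(_ , ¬qx) with residuosity x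
  ... | vanishing x≈0 = ⊥-elim (QNR-≉0 nx x≈0)
  ... | residue qx    = ⊥-elim (¬qx qx)
  ... | nonresidue _  = refl

  χ-±1 : ∀ {x} → x ≉ 0 → χ x ≡ 1ℤ ⊎ χ x ≡ -1ℤ
  χ-±1 {x} x≉0 with residuosity x
  ... | vanishing x≈0 = ⊥-elim (x≉0 x≈0)
  ... | residue _     = inj₁ refl
  ... | nonresidue _  = inj₂ refl

  χ-wellDefined : WellDefined χ
  χ-wellDefined {x} {y} x≈y = by-residuosity (residuosity x)
    where
    by-residuosity : Residuosity x → χ x ≡ χ y
    by-residuosity (vanishing x≈0)          = trans (χ-≈0 x≈0) (sym (χ-≈0 (≈-trans (≈-sym x≈y) x≈0)))
    by-residuosity (residue qx)             = trans (χ-QR qx) (sym (χ-QR (QR-resp x≈y qx)))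
    by-residuosity (nonresidue (x≢0 , ¬qx)) =
      trans (χ-QNR (x≢0 , ¬qx)) (sym (χ-QNR (x≢0 ∘ trans x≈y , ¬qx ∘ QR-resp (≈-sym x≈y))))

  ∑-δ-square : ∀ x → ∑ (λ y → δ x (y ℕ.* y)) ≡ 1ℤ + χ x
  ∑-δ-square x with residuosity x
  ... | vanishing x≈0 = begin
    ∑ (λ y → δ x (y ℕ.* y))   ≡⟨ ∑-cong only-root ⟩
    ∑ (δ 0)                   ≡⟨ ∑-δ 0 ⟩
    1ℤ                        ∎
    where
    open ≡-Reasoning
    only-root : ∀ y → δ x (y ℕ.* y) ≡ δ 0 y
    only-root y = 𝟙-cong (y ℕ.* y ≈? x) (y ≈? 0)
      (λ y²≈x → [ id , id ]′ (*≈0⇒≈0 y y (≈-trans y²≈x x≈0)))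
      (λ y≈0 → ≈-trans (*-zeroˡ-≈ y y≈0) (≈-sym x≈0))
  ... | residue (x≢0 , u , u²≈x) = begin
    ∑ (λ y → δ x (y ℕ.* y))   ≡⟨ ∑-cong two-roots ⟩
    ∑ (λ y → δ z y + δ (neg z) y) ≡⟨ ∑-+ (δ z) (δ (neg z)) ⟩
    ∑ (δ z) + ∑ (δ (neg z))   ≡⟨ cong₂ _+_ (∑-δ z) (∑-δ (neg z)) ⟩
    1ℤ + 1ℤ                   ∎
    where
    open ≡-Reasoning
    z = toℕ u
    z≉0 : z ≉ 0
    z≉0 z≈0 = x≢0 (≈0⇒%p≡0 (≈-trans (≈-sym u²≈x) (*-zeroʳ-≈ z z≈0)))
    two-roots : ∀ y → δ x (y ℕ.* y) ≡ δ z y + δ (neg z) y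
    two-roots y = by-cases (y ≈? z) (y ≈? neg z)
      where
      by-cases : Dec (y ≈ z) → Dec (y ≈ neg z) → δ x (y ℕ.* y) ≡ δ z y + δ (neg z) y
      by-cases (yes y≈z) _ = begin
        δ x (y ℕ.* y)           ≡⟨ δ-≈ (≈-trans (*-cong y≈z y≈z) u²≈x) ⟩
        1ℤ + 0ℤ                 ≡⟨ cong₂ _+_ (δ-≈ y≈z) (δ-≉ (λ y≈-z → ≉neg z≉0 (≈-trans (≈-sym y≈z) y≈-z))) ⟨
        δ z y + δ (neg z) y     ∎
      by-cases (no y≉z) (yes y≈-z) = begin
        δ x (y ℕ.* y)           ≡⟨ δ-≈ (≈-trans (*-cong y≈-z y≈-z) (≈-trans (neg-square z) u²≈x)) ⟩
        0ℤ + 1ℤ                 ≡⟨ cong₂ _+_ (δ-≉ y≉z) (δ-≈ y≈-z) ⟨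
        δ z y + δ (neg z) y     ∎
      by-cases (no y≉z) (no y≉-z) = begin
        δ x (y ℕ.* y)           ≡⟨ δ-≉ (λ y²≈x → [ y≉z , y≉-z ]′ (square-roots y z (≈-trans y²≈x (≈-sym u²≈x)))) ⟩
        0ℤ + 0ℤ                 ≡⟨ cong₂ _+_ (δ-≉ y≉z) (δ-≉ y≉-z) ⟨
        δ z y + δ (neg z) y     ∎
  ... | nonresidue (x≢0 , ¬qx) = begin
    ∑ (λ y → δ x (y ℕ.* y))   ≡⟨ ∑-cong (λ y → δ-≉ (¬qx ∘ square⇒QR y (x≢0 ∘ ≈0⇒%p≡0))) ⟩
    ∑ (λ _ → 0ℤ)              ≡⟨ ∑-const 0ℤ ⟩
    + p * 0ℤ                  ≡⟨ ℤₚ.*-zeroʳ (+ p) ⟩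
    0ℤ                        ∎
    where open ≡-Reasoning

  -- Count the pairs (x , y) with y² ≈ x in two ways.
  ∑χ≡0 : ∑ χ ≡ 0ℤ
  ∑χ≡0 = +-cancelˡ-ℤ (+ p * 1ℤ) (∑ χ) 0ℤ (begin
    + p * 1ℤ + ∑ χ                                ≡⟨ cong (_+ ∑ χ) (∑-const 1ℤ) ⟨
    ∑ (λ _ → 1ℤ) + ∑ χ                            ≡⟨ ∑-+ (λ _ → 1ℤ) χ ⟨
    ∑ (λ x → 1ℤ + χ x)                            ≡⟨ ∑-cong ∑-δ-square ⟨
    ∑ (λ x → ∑ (λ y → δ x (y ℕ.* y)))              ≡⟨ ∑-swap (λ x y → δ x (y ℕ.* y)) ⟩
    ∑ (λ y → ∑ (λ x → δ x (y ℕ.* y)))              ≡⟨ ∑-cong (λ y → trans (∑-cong (λ x → δ-sym x (y ℕ.* y))) (∑-δ (y ℕ.* y))) ⟩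
    ∑ (λ _ → 1ℤ)                                  ≡⟨ ∑-const 1ℤ ⟩
    + p * 1ℤ                                      ≡⟨ ℤₚ.+-identityʳ (+ p * 1ℤ) ⟨
    + p * 1ℤ + 0ℤ                                 ∎)
    where open ≡-Reasoning

  QNR-resp : ∀ {x y} → x ≈ y → QNR p x → QNR p y
  QNR-resp x≈y (x≢0 , ¬qx) = x≢0 ∘ trans x≈y , ¬qx ∘ QR-resp (≈-sym x≈y)

  QR-*-QNR : ∀ {a x} → QR p a → QNR p x → QNR p (a ℕ.* x)
  QR-*-QNR qa nx@(_ , ¬qx) =
    ≉0-¬QR⇒QNR (*-≉0 (QR-≉0 qa) (QNR-≉0 nx)) (¬qx ∘ QR-*-cancelˡ qa (QNR-≉0 nx))

  ¬QNR⇒QR : ∀ {x} → x ≉ 0 → ¬ QNR p x → QR p x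
  ¬QNR⇒QR {x} x≉0 ¬nx with QR? p x
  ... | yes qx  = qx
  ... | no ¬qx  = ⊥-elim (¬nx (≉0-¬QR⇒QNR x≉0 ¬qx))

  𝟙QR 𝟙QNR : ℕ → ℤ
  𝟙QR x  = 𝟙 (QR? p x)
  𝟙QNR x = 𝟙 (QNR? p x)

  χ≡𝟙QR-𝟙QNR : ∀ x → χ x ≡ 𝟙QR x - 𝟙QNR x
  χ≡𝟙QR-𝟙QNR x with residuosity x
  ... | vanishing x≈0 = sym (cong₂ _-_ (𝟙-no (QR? p x) (λ qx → QR-≉0 qx x≈0)) (𝟙-no (QNR? p x) (λ nx → QNR-≉0 nx x≈0)))
  ... | residue qx    = sym (cong₂ _-_ (𝟙-yes (QR? p x) qx) (𝟙-no (QNR? p x) (λ (_ , ¬qx) → ¬qx qx)))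
  ... | nonresidue nx@(_ , ¬qx) = sym (cong₂ _-_ (𝟙-no (QR? p x) ¬qx) (𝟙-yes (QNR? p x) nx))

  ∑𝟙QR≡∑𝟙QNR : ∑ 𝟙QR ≡ ∑ 𝟙QNR
  ∑𝟙QR≡∑𝟙QNR = x∙y⁻¹≈ε⇒x≈y (∑ 𝟙QR) (∑ 𝟙QNR) (begin
    ∑ 𝟙QR - ∑ 𝟙QNR                ≡⟨ cong (λ s → ∑ 𝟙QR + s) (∑-neg 𝟙QNR) ⟨
    ∑ 𝟙QR + ∑ (λ x → - 𝟙QNR x)    ≡⟨ ∑-+ 𝟙QR (λ x → - 𝟙QNR x) ⟨
    ∑ (λ x → 𝟙QR x - 𝟙QNR x)      ≡⟨ ∑-cong χ≡𝟙QR-𝟙QNR ⟨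
    ∑ χ                           ≡⟨ ∑χ≡0 ⟩
    0ℤ                            ∎)
    where open ≡-Reasoning

  𝟙QNR-wellDefined : WellDefined 𝟙QNR
  𝟙QNR-wellDefined {x} {y} x≈y = 𝟙-cong (QNR? p x) (QNR? p y) (QNR-resp x≈y) (QNR-resp (≈-sym x≈y))

  -- Multiplication by a nonresidue a permutes ℤ/p and sends residues to nonresidues; as residues
  -- and nonresidues are equally many, it sends no nonresidue to a nonresidue.
  module _ {a} (na : QNR p a) where
    both? : ∀ y → Dec (QNR p y × QNR p (a ℕ.* y))
    both? y = QNR? p y ×-dec QNR? p (a ℕ.* y)

    𝟙QNR-scaled : ∀ y → 𝟙QNR (a ℕ.* y) ≡ 𝟙QR y + 𝟙 (both? y)
    𝟙QNR-scaled y with residuosity y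
    ... | vanishing y≈0 = trans (𝟙-no (QNR? p (a ℕ.* y)) (λ nay → QNR-≉0 nay (*-zeroʳ-≈ a y≈0)))
      (sym (cong₂ _+_ (𝟙-no (QR? p y) (λ qy → QR-≉0 qy y≈0)) (𝟙-no (both? y) (λ (ny , _) → QNR-≉0 ny y≈0))))
    ... | residue qy = trans (𝟙-yes (QNR? p (a ℕ.* y)) (QNR-resp (≡⇒≈ (ℕₚ.*-comm y a)) (QR-*-QNR qy na)))
      (sym (cong₂ _+_ (𝟙-yes (QR? p y) qy) (𝟙-no (both? y) (λ ((_ , ¬qy) , _) → ¬qy qy))))
    ... | nonresidue ny@(_ , ¬qy) = begin
      𝟙QNR (a ℕ.* y)        ≡⟨ 𝟙-cong (QNR? p (a ℕ.* y)) (both? y) (ny ,_) proj₂ ⟩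
      𝟙 (both? y)           ≡⟨ ℤₚ.+-identityˡ (𝟙 (both? y)) ⟨
      0ℤ + 𝟙 (both? y)      ≡⟨ cong (_+ 𝟙 (both? y)) (𝟙-no (QR? p y) ¬qy) ⟨
      𝟙QR y + 𝟙 (both? y)   ∎
      where open ≡-Reasoning

    ∑𝟙both≡0 : ∑ (λ y → 𝟙 (both? y)) ≡ 0ℤ
    ∑𝟙both≡0 = +-cancelˡ-ℤ (∑ 𝟙QR) _ 0ℤ (begin
      ∑ 𝟙QR + ∑ (λ y → 𝟙 (both? y))    ≡⟨ ∑-+ 𝟙QR (λ y → 𝟙 (both? y)) ⟨
      ∑ (λ y → 𝟙QR y + 𝟙 (both? y))    ≡⟨ ∑-cong 𝟙QNR-scaled ⟨
      ∑ (λ y → 𝟙QNR (a ℕ.* y))          ≡⟨ ∑-reindex (scaling a (QNR-≉0 na)) 𝟙QNR-wellDefined ⟩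
      ∑ 𝟙QNR                           ≡⟨ ∑𝟙QR≡∑𝟙QNR ⟨
      ∑ 𝟙QR                            ≡⟨ ℤₚ.+-identityʳ (∑ 𝟙QR) ⟨
      ∑ 𝟙QR + 0ℤ                       ∎)
      where open ≡-Reasoning

    QNR-*-QNR : ∀ {x} → QNR p x → QR p (a ℕ.* x)
    QNR-*-QNR {x} nx = ¬QNR⇒QR (*-≉0 (QNR-≉0 na) (QNR-≉0 nx)) (λ nax → 𝟙≡0⇒¬ (both? x) (𝟙both≡0 x) (nx , nax))
      where
      𝟙both-wellDefined : WellDefined (λ y → 𝟙 (both? y))
      𝟙both-wellDefined {y} {z} y≈z = 𝟙-cong (both? y) (both? z)
        (Product.map (QNR-resp y≈z) (QNR-resp (*-congˡ a y≈z)))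
        (Product.map (QNR-resp (≈-sym y≈z)) (QNR-resp (*-congˡ a (≈-sym y≈z))))
      𝟙both≡0 : ∀ y → 𝟙 (both? y) ≡ 0ℤ
      𝟙both≡0 = ∑-nonneg≡0⇒≡0 𝟙both-wellDefined (λ y → 𝟙-nonneg (both? y)) ∑𝟙both≡0

  χ-* : ∀ a x → χ (a ℕ.* x) ≡ χ a * χ x
  χ-* a x with residuosity a | residuosity x
  ... | vanishing a≈0 | vanishing _    = χ-≈0 (*-zeroˡ-≈ x a≈0)
  ... | vanishing a≈0 | residue _      = χ-≈0 (*-zeroˡ-≈ x a≈0)
  ... | vanishing a≈0 | nonresidue _   = χ-≈0 (*-zeroˡ-≈ x a≈0)
  ... | residue _     | vanishing x≈0  = χ-≈0 (*-zeroʳ-≈ a x≈0)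
  ... | nonresidue _  | vanishing x≈0  = χ-≈0 (*-zeroʳ-≈ a x≈0)
  ... | residue qa    | residue qx     = χ-QR (QR-* qa qx)
  ... | residue qa    | nonresidue nx  = χ-QNR (QR-*-QNR qa nx)
  ... | nonresidue na | residue qx     = χ-QNR (QNR-resp (≡⇒≈ (ℕₚ.*-comm x a)) (QR-*-QNR qx na))
  ... | nonresidue na | nonresidue nx  = χ-QR (QNR-*-QNR na nx)

module CharacterSums (p : ℕ) .{{_ : NonZero p}} (p-prime : Prime p) (2<p : 2 ℕ.< p) where
  open import Data.Integer.Base using (-_; _+_; _*_)
  open import Algebra.Properties.AbelianGroup ℤₚ.+-0-abelianGroup using (inverseˡ-unique)
  open QuadraticCharacter p p-prime 2<p public

  χ-1 : χ 1 ≡ 1ℤ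
  χ-1 = χ-QR (square⇒QR 1 1≉0 ≈-refl)

  χ²≡1 : ∀ {x} → x ≉ 0 → χ x * χ x ≡ 1ℤ
  χ²≡1 {x} x≉0 with residuosity x
  ... | vanishing x≈0 = ⊥-elim (x≉0 x≈0)
  ... | residue _     = refl
  ... | nonresidue _  = refl

  χ-inv : ∀ {x} → x ≉ 0 → χ (inv x) ≡ χ x
  χ-inv {x} x≉0 = begin
    χ (inv x)                     ≡⟨ ℤₚ.*-identityʳ (χ (inv x)) ⟨
    χ (inv x) * 1ℤ                ≡⟨ cong (χ (inv x) *_) (χ²≡1 x≉0) ⟨
    χ (inv x) * (χ x * χ x)       ≡⟨ ℤₚ.*-assoc (χ (inv x)) (χ x) (χ x) ⟨
    χ (inv x) * χ x * χ x         ≡⟨ cong (_* χ x) (χ-* (inv x) x) ⟨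
    χ (inv x ℕ.* x) * χ x         ≡⟨ cong (_* χ x) (χ-wellDefined (*-inverseˡ x≉0)) ⟩
    χ 1 * χ x                     ≡⟨ cong (_* χ x) χ-1 ⟩
    1ℤ * χ x                      ≡⟨ ℤₚ.*-identityˡ (χ x) ⟩
    χ x                           ∎
    where open ≡-Reasoning

  ∑χ-translate : ∀ c → ∑ (λ x → χ (x ℕ.+ c)) ≡ 0ℤ
  ∑χ-translate c = trans (∑-reindex (translation c) χ-wellDefined) ∑χ≡0

  -- For x ≉ 0, χ x * χ (x + c) = χ (inv x * (x + c)) = χ (1 + c * inv x); the term δ 0 x makes
  -- the identity hold at x ≈ 0 too, and then x ↦ inv x and y ↦ c * y reduce the sum to ∑ χ.
  ∑χχ≡-1 : ∀ c → c ≉ 0 → ∑ (λ x → χ x * χ (x ℕ.+ c)) ≡ -1ℤ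
  ∑χχ≡-1 c c≉0 = inverseˡ-unique _ 1ℤ (begin
    ∑ (λ x → χ x * χ (x ℕ.+ c)) + 1ℤ       ≡⟨ cong (λ s → ∑ (λ x → χ x * χ (x ℕ.+ c)) + s) (∑-δ 0) ⟨
    ∑ (λ x → χ x * χ (x ℕ.+ c)) + ∑ (δ 0)  ≡⟨ ∑-+ (λ x → χ x * χ (x ℕ.+ c)) (δ 0) ⟨
    ∑ (λ x → χ x * χ (x ℕ.+ c) + δ 0 x)    ≡⟨ ∑-cong via-inverse ⟩
    ∑ (f ∘ inv)                            ≡⟨ ∑-reindex inversion f-wellDefined ⟩
    ∑ f                                    ≡⟨ ∑-reindex (scaling c c≉0) (λ y≈z → χ-wellDefined (+-congˡ 1 y≈z)) ⟩
    ∑ (λ y → χ (1 ℕ.+ y))                  ≡⟨ ∑-cong (λ y → cong χ (ℕₚ.+-comm 1 y)) ⟩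
    ∑ (λ y → χ (y ℕ.+ 1))                  ≡⟨ ∑χ-translate 1 ⟩
    0ℤ                                     ∎)
    where
    open ≡-Reasoning
    f : ℕ → ℤ
    f y = χ (1 ℕ.+ c ℕ.* y)
    f-wellDefined : WellDefined f
    f-wellDefined y≈z = χ-wellDefined (+-congˡ 1 (*-congˡ c y≈z))
    via-inverse : ∀ x → χ x * χ (x ℕ.+ c) + δ 0 x ≡ f (inv x)
    via-inverse x = by-cases (≈0? x)
      where
      by-cases : Dec (x ≈ 0) → χ x * χ (x ℕ.+ c) + δ 0 x ≡ f (inv x)
      by-cases (yes x≈0) = begin
        χ x * χ (x ℕ.+ c) + δ 0 x   ≡⟨ cong₂ (λ u v → u * χ (x ℕ.+ c) + v) (χ-≈0 x≈0) (δ-≈ x≈0) ⟩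
        0ℤ * χ (x ℕ.+ c) + 1ℤ       ≡⟨ cong (_+ 1ℤ) (ℤₚ.*-zeroˡ (χ (x ℕ.+ c))) ⟩
        1ℤ                          ≡⟨ χ-1 ⟨
        χ 1                         ≡⟨ cong (λ y → χ (1 ℕ.+ y)) (trans (cong (c ℕ.*_) (inv-≈0 x≈0)) (ℕₚ.*-zeroʳ c)) ⟨
        f (inv x)                   ∎
      by-cases (no x≉0) = begin
        χ x * χ (x ℕ.+ c) + δ 0 x   ≡⟨ cong₂ (λ u v → u * χ (x ℕ.+ c) + v) (χ-inv x≉0) (sym (δ-≉ x≉0)) ⟨
        χ (inv x) * χ (x ℕ.+ c) + 0ℤ ≡⟨ ℤₚ.+-identityʳ _ ⟩
        χ (inv x) * χ (x ℕ.+ c)     ≡⟨ χ-* (inv x) (x ℕ.+ c) ⟨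
        χ (inv x ℕ.* (x ℕ.+ c))     ≡⟨ χ-wellDefined inv[x]·[x+c]≈1+c·inv[x] ⟩
        f (inv x)                   ∎
        where
        inv[x]·[x+c]≈1+c·inv[x] : inv x ℕ.* (x ℕ.+ c) ≈ 1 ℕ.+ c ℕ.* inv x
        inv[x]·[x+c]≈1+c·inv[x] = ≈-trans
          (≡⇒≈ (trans (ℕₚ.*-distribˡ-+ (inv x) x c) (cong (inv x ℕ.* x ℕ.+_) (ℕₚ.*-comm (inv x) c))))
          (+-congʳ (c ℕ.* inv x) (*-inverseˡ x≉0))

  χ-neg : ∀ y → χ (neg y) ≡ χ (neg 1) * χ y
  χ-neg y = trans (χ-wellDefined neg[y]≈neg[1]·y) (χ-* (neg 1) y)
    where
    neg[y]≈neg[1]·y : neg y ≈ neg 1 ℕ.* y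
    neg[y]≈neg[1]·y = begin
      neg y             ≡⟨ cong neg (ℕₚ.*-identityʳ y) ⟨
      neg (y ℕ.* 1)     ≈⟨ *-distrib-neg y 1 ⟨
      y ℕ.* neg 1       ≡⟨ ℕₚ.*-comm y (neg 1) ⟩
      neg 1 ℕ.* y       ∎
      where open ≈-Reasoning

  -- The reflection x ↦ neg (x + 2) maps x, x + 1, x + 2 to −(x + 2), −(x + 1), −x, so it negates each term.
  ∑χχχ≡0 : χ (neg 1) ≡ -1ℤ → ∑ (λ x → χ x * χ (x ℕ.+ 1) * χ (x ℕ.+ 2)) ≡ 0ℤ
  ∑χχχ≡0 χ[-1]≡-1 = i≡-i⇒i≡0 (begin
    ∑ T                         ≡⟨ ∑-reindex (reflection 2) T-wellDefined ⟨
    ∑ (λ x → T (neg (x ℕ.+ 2))) ≡⟨ ∑-cong T-reflect ⟩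
    ∑ (λ x → - T x)             ≡⟨ ∑-neg T ⟩
    - ∑ T                       ∎)
    where
    open ≡-Reasoning
    T : ℕ → ℤ
    T x = χ x * χ (x ℕ.+ 1) * χ (x ℕ.+ 2)

    T-wellDefined : WellDefined T
    T-wellDefined x≈y = cong₂ _*_ (cong₂ _*_ (χ-wellDefined x≈y) (χ-wellDefined (+-congʳ 1 x≈y))) (χ-wellDefined (+-congʳ 2 x≈y))

    χ-neg≡-χ : ∀ y → χ (neg y) ≡ - χ y
    χ-neg≡-χ y = trans (χ-neg y) (trans (cong (_* χ y) χ[-1]≡-1) (ℤₚ.-1*i≡-i (χ y)))

    odd : ∀ a b c → - c * - b * - a ≡ - (a * b * c)
    odd = ℤ-Solver.solve-∀

    T-reflect : ∀ x → T (neg (x ℕ.+ 2)) ≡ - T x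
    T-reflect x = begin
      χ (neg (x ℕ.+ 2)) * χ (neg (x ℕ.+ 2) ℕ.+ 1) * χ (neg (x ℕ.+ 2) ℕ.+ 2)
        ≡⟨ cong₂ _*_ (cong₂ _*_ (χ-neg≡-χ (x ℕ.+ 2))
                                (trans (χ-wellDefined (neg[x+[m+k]]+k≈neg[x+m] x 1 1)) (χ-neg≡-χ (x ℕ.+ 1))))
                     (trans (χ-wellDefined (≈-trans (neg[x+[m+k]]+k≈neg[x+m] x 0 2) (≡⇒≈ (cong neg (ℕₚ.+-identityʳ x))))) (χ-neg≡-χ x)) ⟩
      - χ (x ℕ.+ 2) * - χ (x ℕ.+ 1) * - χ x
        ≡⟨ odd (χ x) (χ (x ℕ.+ 1)) (χ (x ℕ.+ 2)) ⟩
      - T x ∎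

  ∑χχ-translate≡-1 : ∀ k c → c ≉ 0 → ∑ (λ x → χ (x ℕ.+ k) * χ (x ℕ.+ (k ℕ.+ c))) ≡ -1ℤ
  ∑χχ-translate≡-1 k c c≉0 = begin
    ∑ (λ x → χ (x ℕ.+ k) * χ (x ℕ.+ (k ℕ.+ c)))   ≡⟨ ∑-cong (λ x → cong (λ y → χ (x ℕ.+ k) * χ y) (ℕₚ.+-assoc x k c)) ⟨
    ∑ (λ x → χ (x ℕ.+ k) * χ (x ℕ.+ k ℕ.+ c))     ≡⟨ ∑-reindex (translation k) χχ-wellDefined ⟩
    ∑ (λ x → χ x * χ (x ℕ.+ c))                   ≡⟨ ∑χχ≡-1 c c≉0 ⟩
    -1ℤ                                           ∎
    where
    open ≡-Reasoning
    χχ-wellDefined : WellDefined (λ x → χ x * χ (x ℕ.+ c))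
    χχ-wellDefined x≈y = cong₂ _*_ (χ-wellDefined x≈y) (χ-wellDefined (+-congʳ c x≈y))

module PatternCount (p : ℕ) .{{_ : NonZero p}} (p-prime : Prime p) (2<p : 2 ℕ.< p) where
  open import Data.Integer.Base using (+_; _+_; _-_; _*_)
  open FinSum using (sum; length-filter-tabulate)
  open SemiringSum ℤₚ.+-*-semiring using (∑-distrib-+; sum-cong-≗; *-distribˡ-sum)
  open CharacterSums p p-prime 2<p public

  sign : Letter → ℤ
  sign Letter.r = 1ℤ
  sign Letter.n = -1ℤ

  -- The constant term of the occurrence formula, with t and s standing for χ(−1) and χ(2).
  defect : ℤ → ℤ → ℤ → ℤ → ℤ → ℤ
  defect a b c t s = a * b + a * c + b * c
    + ((1ℤ + b) * (1ℤ + c * s) + (1ℤ + a * t) * (1ℤ + c) + (1ℤ + a * (t * s)) * (1ℤ + b * t))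

  defect-values : ∀ l₀ l₁ l₂ {s} → s ≡ 1ℤ ⊎ s ≡ -1ℤ →
                  let d = defect (sign l₀) (sign l₁) (sign l₂) -1ℤ s in d ≡ + 3 ⊎ d ≡ + 7 ⊎ d ≡ -1ℤ
  defect-values Letter.r Letter.r Letter.r (inj₁ refl) = inj₂ (inj₁ refl)
  defect-values Letter.r Letter.r Letter.n (inj₁ refl) = inj₂ (inj₂ refl)
  defect-values Letter.r Letter.n Letter.r (inj₁ refl) = inj₂ (inj₂ refl)
  defect-values Letter.r Letter.n Letter.n (inj₁ refl) = inj₂ (inj₂ refl)
  defect-values Letter.n Letter.r Letter.r (inj₁ refl) = inj₂ (inj₁ refl)
  defect-values Letter.n Letter.r Letter.n (inj₁ refl) = inj₂ (inj₂ refl)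
  defect-values Letter.n Letter.n Letter.r (inj₁ refl) = inj₂ (inj₁ refl)
  defect-values Letter.n Letter.n Letter.n (inj₁ refl) = inj₂ (inj₁ refl)
  defect-values Letter.r Letter.r Letter.r (inj₂ refl) = inj₁ refl
  defect-values Letter.r Letter.r Letter.n (inj₂ refl) = inj₁ refl
  defect-values Letter.r Letter.n Letter.r (inj₂ refl) = inj₁ refl
  defect-values Letter.r Letter.n Letter.n (inj₂ refl) = inj₁ refl
  defect-values Letter.n Letter.r Letter.r (inj₂ refl) = inj₁ refl
  defect-values Letter.n Letter.r Letter.n (inj₂ refl) = inj₁ refl
  defect-values Letter.n Letter.n Letter.r (inj₂ refl) = inj₁ refl
  defect-values Letter.n Letter.n Letter.n (inj₂ refl) = inj₁ refl

  factor : Letter → ℕ → ℤ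
  factor l y = 1ℤ + sign l * χ y

  matches : Letter → ℕ → ℤ
  matches l y = 𝟙 (Matches? p l y)

  factor-wellDefined : ∀ l → WellDefined (factor l)
  factor-wellDefined l x≈y = cong (λ v → 1ℤ + sign l * v) (χ-wellDefined x≈y)

  factor-≈0 : ∀ l {y} → y ≈ 0 → factor l y ≡ 1ℤ
  factor-≈0 l y≈0 = begin
    1ℤ + sign l * χ _   ≡⟨ cong (λ v → 1ℤ + sign l * v) (χ-≈0 y≈0) ⟩
    1ℤ + sign l * 0ℤ    ≡⟨ cong (λ s → 1ℤ + s) (ℤₚ.*-zeroʳ (sign l)) ⟩
    1ℤ                  ∎
    where open ≡-Reasoning

  matches-≈0 : ∀ l {y} → y ≈ 0 → matches l y ≡ 0ℤ
  matches-≈0 Letter.r {y} y≈0 = 𝟙-no (QR? p y) (λ qy → QR-≉0 qy y≈0)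
  matches-≈0 Letter.n {y} y≈0 = 𝟙-no (QNR? p y) (λ ny → QNR-≉0 ny y≈0)

  factor-≉0 : ∀ l {y} → y ≉ 0 → factor l y ≡ + 2 * matches l y
  factor-≉0 l {y} y≉0 with residuosity y
  ... | vanishing y≈0 = ⊥-elim (y≉0 y≈0)
  factor-≉0 Letter.r {y} y≉0 | residue qy = cong (+ 2 *_) (sym (𝟙-yes (QR? p y) qy))
  factor-≉0 Letter.n {y} y≉0 | residue qy = cong (+ 2 *_) (sym (𝟙-no (QNR? p y) (λ (_ , ¬qy) → ¬qy qy)))
  factor-≉0 Letter.r {y} y≉0 | nonresidue (_ , ¬qy) = cong (+ 2 *_) (sym (𝟙-no (QR? p y) ¬qy))
  factor-≉0 Letter.n {y} y≉0 | nonresidue ny = cong (+ 2 *_) (sym (𝟙-yes (QNR? p y) ny))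

  private
    only₀ : ∀ m₁ m₂ g₀ g₁ g₂ → + 8 * (0ℤ * m₁ * m₂) + (1ℤ * g₀ + 0ℤ * g₁ + 0ℤ * g₂) ≡ g₀
    only₀ = ℤ-Solver.solve-∀
    only₁ : ∀ m₀ m₂ g₀ g₁ g₂ → + 8 * (m₀ * 0ℤ * m₂) + (0ℤ * g₀ + 1ℤ * g₁ + 0ℤ * g₂) ≡ g₁
    only₁ = ℤ-Solver.solve-∀
    only₂ : ∀ m₀ m₁ g₀ g₁ g₂ → + 8 * (m₀ * m₁ * 0ℤ) + (0ℤ * g₀ + 0ℤ * g₁ + 1ℤ * g₂) ≡ g₂
    only₂ = ℤ-Solver.solve-∀
    none : ∀ m₀ m₁ m₂ g₀ g₁ g₂ → + 2 * m₀ * (+ 2 * m₁) * (+ 2 * m₂) ≡ + 8 * (m₀ * m₁ * m₂) + (0ℤ * g₀ + 0ℤ * g₁ + 0ℤ * g₂)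
    none = ℤ-Solver.solve-∀

  module _ (l₀ l₁ l₂ : Letter) where
    w : Pattern 3
    w = l₀ ∷ l₁ ∷ l₂ ∷ []

    a b c : ℤ
    a = sign l₀
    b = sign l₁
    c = sign l₂

    -- x + 0 rather than x matches Occurrence, which reads position i at toℕ a + toℕ i.
    F : ℕ → ℤ
    F x = factor l₀ (x ℕ.+ 0) * factor l₁ (x ℕ.+ 1) * factor l₂ (x ℕ.+ 2)

    g₀ g₁ g₂ : ℤ
    g₀ = factor l₁ 1 * factor l₂ 2
    g₁ = factor l₀ (neg 1) * factor l₂ 1
    g₂ = factor l₀ (neg 2) * factor l₁ (neg 1)

    corrections : ℕ → ℤ
    corrections x = δ 0 (x ℕ.+ 0) * g₀ + δ 0 (x ℕ.+ 1) * g₁ + δ 0 (x ℕ.+ 2) * g₂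

    occurrence-indicator : ∀ i → 𝟙 (Occurrence? p w i)
                             ≡ matches l₀ (toℕ i ℕ.+ 0) * matches l₁ (toℕ i ℕ.+ 1) * matches l₂ (toℕ i ℕ.+ 2)
    occurrence-indicator i = begin
      𝟙 (Occurrence? p w i)           ≡⟨ 𝟙-cong (Occurrence? p w i) (M₀? ×-dec M₁? ×-dec M₂?)
                                              (λ o → o Fin.zero , o (Fin.suc Fin.zero) , o (Fin.suc (Fin.suc Fin.zero)))
                                              (λ { (m₀ , m₁ , m₂) Fin.zero → m₀ ; (m₀ , m₁ , m₂) (Fin.suc Fin.zero) → m₁
                                                 ; (m₀ , m₁ , m₂) (Fin.suc (Fin.suc Fin.zero)) → m₂ }) ⟩
      𝟙 (M₀? ×-dec M₁? ×-dec M₂?)    ≡⟨ trans (𝟙-×-dec M₀? _) (cong (𝟙 M₀? *_) (𝟙-×-dec M₁? M₂?)) ⟩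
      𝟙 M₀? * (𝟙 M₁? * 𝟙 M₂?)         ≡⟨ ℤₚ.*-assoc (𝟙 M₀?) _ _ ⟨
      𝟙 M₀? * 𝟙 M₁? * 𝟙 M₂?           ∎
      where
      open ≡-Reasoning
      M₀? = Matches? p l₀ (toℕ i ℕ.+ 0)
      M₁? = Matches? p l₁ (toℕ i ℕ.+ 1)
      M₂? = Matches? p l₂ (toℕ i ℕ.+ 2)

    -- As p > 2 at most one of x, x + 1, x + 2 is ≈ 0; its factor is 1 and the other two are the
    -- constant gᵢ.  Otherwise every factor is twice an indicator.
    F≡8·occurrence+corrections : ∀ i → F (toℕ i) ≡ + 8 * 𝟙 (Occurrence? p w i) + corrections (toℕ i)
    F≡8·occurrence+corrections i rewrite occurrence-indicator i = by-cases (≈0? (x ℕ.+ 0)) (≈0? (x ℕ.+ 1)) (≈0? (x ℕ.+ 2))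
      where
      open ≡-Reasoning
      x = toℕ i
      M₀ = matches l₀ (x ℕ.+ 0)
      M₁ = matches l₁ (x ℕ.+ 1)
      M₂ = matches l₂ (x ℕ.+ 2)

      target : ∀ {m₀ m₁ m₂ d₀ d₁ d₂} → M₀ ≡ m₀ → M₁ ≡ m₁ → M₂ ≡ m₂ →
               δ 0 (x ℕ.+ 0) ≡ d₀ → δ 0 (x ℕ.+ 1) ≡ d₁ → δ 0 (x ℕ.+ 2) ≡ d₂ →
               + 8 * (M₀ * M₁ * M₂) + corrections x ≡ + 8 * (m₀ * m₁ * m₂) + (d₀ * g₀ + d₁ * g₁ + d₂ * g₂)
      target refl refl refl refl refl refl = refl

      by-cases : Dec (x ℕ.+ 0 ≈ 0) → Dec (x ℕ.+ 1 ≈ 0) → Dec (x ℕ.+ 2 ≈ 0) → F x ≡ + 8 * (M₀ * M₁ * M₂) + corrections x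
      by-cases (yes x≈0) _ _ = begin
        F x                                ≡⟨ cong₂ _*_ (cong₂ _*_ (factor-≈0 l₀ x≈0) (factor-wellDefined l₁ (x+m≈0⇒x+[m+k]≈k x 0 1 x≈0)))
                                                        (factor-wellDefined l₂ (x+m≈0⇒x+[m+k]≈k x 0 2 x≈0)) ⟩
        1ℤ * factor l₁ 1 * factor l₂ 2     ≡⟨ cong (_* factor l₂ 2) (ℤₚ.*-identityˡ (factor l₁ 1)) ⟩
        g₀                                 ≡⟨ only₀ M₁ M₂ g₀ g₁ g₂ ⟨
        _                                  ≡⟨ target (matches-≈0 l₀ x≈0) refl refl (δ-≈ x≈0)
                                               (δ-≉ (1≉0 ∘ ≈-trans (≈-sym (x+m≈0⇒x+[m+k]≈k x 0 1 x≈0))))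
                                               (δ-≉ (2≉0 ∘ ≈-trans (≈-sym (x+m≈0⇒x+[m+k]≈k x 0 2 x≈0)))) ⟨
        + 8 * (M₀ * M₁ * M₂) + corrections x ∎
      by-cases (no x≉0) (yes x+1≈0) _ = begin
        F x                                ≡⟨ cong₂ _*_ (cong₂ _*_ (factor-wellDefined l₀ (x+[m+k]≈0⇒x+m≈neg[k] x 0 1 x+1≈0)) (factor-≈0 l₁ x+1≈0))
                                                        (factor-wellDefined l₂ (x+m≈0⇒x+[m+k]≈k x 1 1 x+1≈0)) ⟩
        factor l₀ (neg 1) * 1ℤ * factor l₂ 1 ≡⟨ cong (_* factor l₂ 1) (ℤₚ.*-identityʳ (factor l₀ (neg 1))) ⟩
        g₁                                 ≡⟨ only₁ M₀ M₂ g₀ g₁ g₂ ⟨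
        _                                  ≡⟨ target refl (matches-≈0 l₁ x+1≈0) refl (δ-≉ x≉0) (δ-≈ x+1≈0)
                                               (δ-≉ (1≉0 ∘ ≈-trans (≈-sym (x+m≈0⇒x+[m+k]≈k x 1 1 x+1≈0)))) ⟨
        + 8 * (M₀ * M₁ * M₂) + corrections x ∎
      by-cases (no x≉0) (no x+1≉0) (yes x+2≈0) = begin
        F x                                ≡⟨ cong₂ _*_ (cong₂ _*_ (factor-wellDefined l₀ (x+[m+k]≈0⇒x+m≈neg[k] x 0 2 x+2≈0)) (factor-wellDefined l₁ (x+[m+k]≈0⇒x+m≈neg[k] x 1 1 x+2≈0)))
                                                        (factor-≈0 l₂ x+2≈0) ⟩
        factor l₀ (neg 2) * factor l₁ (neg 1) * 1ℤ ≡⟨ ℤₚ.*-identityʳ g₂ ⟩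
        g₂                                 ≡⟨ only₂ M₀ M₁ g₀ g₁ g₂ ⟨
        _                                  ≡⟨ target refl refl (matches-≈0 l₂ x+2≈0) (δ-≉ x≉0) (δ-≉ x+1≉0) (δ-≈ x+2≈0) ⟨
        + 8 * (M₀ * M₁ * M₂) + corrections x ∎
      by-cases (no x≉0) (no x+1≉0) (no x+2≉0) = begin
        F x                                ≡⟨ cong₂ _*_ (cong₂ _*_ (factor-≉0 l₀ x≉0) (factor-≉0 l₁ x+1≉0)) (factor-≉0 l₂ x+2≉0) ⟩
        + 2 * M₀ * (+ 2 * M₁) * (+ 2 * M₂) ≡⟨ none M₀ M₁ M₂ g₀ g₁ g₂ ⟩
        _                                  ≡⟨ target refl refl refl (δ-≉ x≉0) (δ-≉ x+1≉0) (δ-≉ x+2≉0) ⟨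
        + 8 * (M₀ * M₁ * M₂) + corrections x ∎

    ∑corrections : ∑ corrections ≡ g₀ + g₁ + g₂
    ∑corrections = begin
      ∑ corrections                                    ≡⟨ ∑-+ (λ x → δ 0 (x ℕ.+ 0) * g₀ + δ 0 (x ℕ.+ 1) * g₁) (λ x → δ 0 (x ℕ.+ 2) * g₂) ⟩
      ∑ (λ x → δ 0 (x ℕ.+ 0) * g₀ + δ 0 (x ℕ.+ 1) * g₁) + ∑ (λ x → δ 0 (x ℕ.+ 2) * g₂)
                                                       ≡⟨ cong (_+ ∑ (λ x → δ 0 (x ℕ.+ 2) * g₂)) (∑-+ (λ x → δ 0 (x ℕ.+ 0) * g₀) (λ x → δ 0 (x ℕ.+ 1) * g₁)) ⟩
      ∑ (λ x → δ 0 (x ℕ.+ 0) * g₀) + ∑ (λ x → δ 0 (x ℕ.+ 1) * g₁) + ∑ (λ x → δ 0 (x ℕ.+ 2) * g₂)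
                                                       ≡⟨ cong₂ _+_ (cong₂ _+_ (∑δ-translate 0 g₀) (∑δ-translate 1 g₁)) (∑δ-translate 2 g₂) ⟩
      g₀ + g₁ + g₂                                     ∎
      where
      open ≡-Reasoning
      ∑δ-translate : ∀ k g → ∑ (λ x → δ 0 (x ℕ.+ k) * g) ≡ g
      ∑δ-translate k g = begin
        ∑ (λ x → δ 0 (x ℕ.+ k) * g)   ≡⟨ ∑-cong (λ x → ℤₚ.*-comm (δ 0 (x ℕ.+ k)) g) ⟩
        ∑ (λ x → g * δ 0 (x ℕ.+ k))   ≡⟨ ∑-*ˡ g (λ x → δ 0 (x ℕ.+ k)) ⟩
        g * ∑ (λ x → δ 0 (x ℕ.+ k))   ≡⟨ cong (g *_) (trans (∑-reindex (translation k) (δ-wellDefined 0)) (∑-δ 0)) ⟩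
        g * 1ℤ                        ≡⟨ ℤₚ.*-identityʳ g ⟩
        g                             ∎

    occurrence-count : + 8 * + occurrences p w + (g₀ + g₁ + g₂)
                         ≡ + p - (a * b + a * c + b * c) + a * b * c * ∑ (λ x → χ (x ℕ.+ 0) * χ (x ℕ.+ 1) * χ (x ℕ.+ 2))
    occurrence-count = begin
      + 8 * + occurrences p w + (g₀ + g₁ + g₂)
        ≡⟨ cong₂ _+_ (cong (+ 8 *_) (length-filter-tabulate (Occurrence? p w) id)) (sym ∑corrections) ⟩
      + 8 * sum (λ i → 𝟙 (Occurrence? p w i)) + ∑ corrections
        ≡⟨ cong (_+ ∑ corrections) (*-distribˡ-sum (+ 8) (λ i → 𝟙 (Occurrence? p w i))) ⟩
      sum (λ i → + 8 * 𝟙 (Occurrence? p w i)) + ∑ corrections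
        ≡⟨ ∑-distrib-+ (λ i → + 8 * 𝟙 (Occurrence? p w i)) (corrections ∘ toℕ) ⟨
      sum (λ i → + 8 * 𝟙 (Occurrence? p w i) + corrections (toℕ i))
        ≡⟨ sum-cong-≗ {p} (λ i → sym (F≡8·occurrence+corrections i)) ⟩
      ∑ F
        ≡⟨ ∑-product₃ a b c (λ x → χ (x ℕ.+ 0)) (λ x → χ (x ℕ.+ 1)) (λ x → χ (x ℕ.+ 2))
                      (∑χ-translate 0) (∑χ-translate 1) (∑χ-translate 2)
                      (∑χχ-translate≡-1 0 1 1≉0) (∑χχ-translate≡-1 0 2 2≉0) (∑χχ-translate≡-1 1 1 1≉0) ⟩
      + p - (a * b + a * c + b * c) + a * b * c * ∑ (λ x → χ (x ℕ.+ 0) * χ (x ℕ.+ 1) * χ (x ℕ.+ 2))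
        ∎
      where open ≡-Reasoning

    eight-occurrences : + 8 * + occurrences p w + defect a b c (χ (neg 1)) (χ 2)
                          ≡ + p + a * b * c * ∑ (λ x → χ x * χ (x ℕ.+ 1) * χ (x ℕ.+ 2))
    eight-occurrences = begin
      N₈ + (Q + C)                  ≡⟨ swap N₈ Q C ⟩
      Q + (N₈ + C)                  ≡⟨ cong (λ u → Q + (N₈ + u)) corrections-value ⟨
      Q + (N₈ + (g₀ + g₁ + g₂))     ≡⟨ cong (λ u → Q + u) occurrence-count ⟩
      Q + (+ p - Q + a * b * c * X₀) ≡⟨ cancel Q (+ p) (a * b * c * X₀) ⟩
      + p + a * b * c * X₀          ≡⟨ cong (λ u → + p + a * b * c * u) (∑-cong (λ x → cong (λ y → χ y * χ (x ℕ.+ 1) * χ (x ℕ.+ 2)) (ℕₚ.+-identityʳ x))) ⟩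
      + p + a * b * c * ∑ (λ x → χ x * χ (x ℕ.+ 1) * χ (x ℕ.+ 2)) ∎
      where
      open ≡-Reasoning
      t s N₈ Q C X₀ : ℤ
      t  = χ (neg 1)
      s  = χ 2
      N₈ = + 8 * + occurrences p w
      Q  = a * b + a * c + b * c
      C  = (1ℤ + b) * (1ℤ + c * s) + (1ℤ + a * t) * (1ℤ + c) + (1ℤ + a * (t * s)) * (1ℤ + b * t)
      X₀ = ∑ (λ x → χ (x ℕ.+ 0) * χ (x ℕ.+ 1) * χ (x ℕ.+ 2))

      swap : ∀ n q c → n + (q + c) ≡ q + (n + c)
      swap = ℤ-Solver.solve-∀
      cancel : ∀ q p y → q + (p - q + y) ≡ p + y
      cancel = ℤ-Solver.solve-∀
      evaluate : ∀ a b c t s → (1ℤ + b * 1ℤ) * (1ℤ + c * s) + (1ℤ + a * t) * (1ℤ + c * 1ℤ) + (1ℤ + a * (t * s)) * (1ℤ + b * t)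
                               ≡ (1ℤ + b) * (1ℤ + c * s) + (1ℤ + a * t) * (1ℤ + c) + (1ℤ + a * (t * s)) * (1ℤ + b * t)
      evaluate = ℤ-Solver.solve-∀

      corrections-value : g₀ + g₁ + g₂ ≡ C
      corrections-value = begin
        g₀ + g₁ + g₂    ≡⟨ cong₂ (λ u v → (1ℤ + b * u) * (1ℤ + c * s) + (1ℤ + a * t) * (1ℤ + c * u) + (1ℤ + a * v) * (1ℤ + b * t))
                                 χ-1 (χ-neg 2) ⟩
        _               ≡⟨ evaluate a b c t s ⟩
        C               ∎

module EighthsArithmetic where
  open import Data.Nat.Base using (_+_; _*_; _∸_; _≤_; _<_)
  open import Data.Integer.Base as ℤ using (+_)

  [k+m*8]/8≡m : ∀ m k → k < 8 → (k + m * 8) / 8 ≡ m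
  [k+m*8]/8≡m m k k<8 = begin
    (k + m * 8) / 8      ≡⟨ +-distrib-/-∣ʳ k (n∣m*n m) ⟩
    k / 8 + m * 8 / 8    ≡⟨ cong₂ _+_ (m<n⇒m/n≡0 k<8) (m*n/n≡m m 8) ⟩
    m                    ∎
    where open ≡-Reasoning

  8*+k≡+ : ∀ m k → + 8 ℤ.* + m ℤ.+ + k ≡ + (8 * m + k)
  8*+k≡+ m k = trans (cong (ℤ._+ + k) (sym (ℤₚ.pos-* 8 m))) (sym (ℤₚ.pos-+ (8 * m) k))

  floor-or-ceil : ∀ {m p d} → 3 ≤ p → + 8 ℤ.* + m ℤ.+ d ≡ + p → d ≡ + 3 ⊎ d ≡ + 7 ⊎ d ≡ -1ℤ →
                  m ≡ (p ∸ 3) / 8 ⊎ m ≡ (p ∸ 3 + 7) / 8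
  floor-or-ceil {m} {p} _ 8m+3≡p (inj₁ refl) = inj₁ (sym (begin
    (p ∸ 3) / 8          ≡⟨ cong (λ q → (q ∸ 3) / 8) (ℤₚ.+-injective (trans (sym (8*+k≡+ m 3)) 8m+3≡p)) ⟨
    (8 * m + 3 ∸ 3) / 8  ≡⟨ cong (_/ 8) (trans (ℕₚ.m+n∸n≡m (8 * m) 3) (ℕₚ.*-comm 8 m)) ⟩
    (0 + m * 8) / 8      ≡⟨ [k+m*8]/8≡m m 0 (s≤s z≤n) ⟩
    m                    ∎))
    where open ≡-Reasoning
  floor-or-ceil {m} {p} _ 8m+7≡p (inj₂ (inj₁ refl)) = inj₁ (sym (begin
    (p ∸ 3) / 8          ≡⟨ cong (λ q → (q ∸ 3) / 8) (ℤₚ.+-injective (trans (sym (8*+k≡+ m 7)) 8m+7≡p)) ⟨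
    (8 * m + 7 ∸ 3) / 8  ≡⟨ cong (_/ 8) (trans (ℕₚ.+-∸-assoc (8 * m) (s≤s (s≤s (s≤s z≤n)))) (ℕₚ.+-comm (8 * m) 4)) ⟩
    (4 + 8 * m) / 8      ≡⟨ cong (λ q → (4 + q) / 8) (ℕₚ.*-comm 8 m) ⟩
    (4 + m * 8) / 8      ≡⟨ [k+m*8]/8≡m m 4 (s≤s (s≤s (s≤s (s≤s (s≤s z≤n))))) ⟩
    m                    ∎))
    where open ≡-Reasoning
  floor-or-ceil {m} {p} 3≤p 8m-1≡p (inj₂ (inj₂ refl)) = inj₂ (sym (begin
    (p ∸ 3 + 7) / 8      ≡⟨ cong (_/ 8) (ℕₚ.+-assoc (p ∸ 3) 3 4) ⟨
    (p ∸ 3 + 3 + 4) / 8  ≡⟨ cong (λ q → (q + 4) / 8) (ℕₚ.m∸n+n≡m 3≤p) ⟩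
    (p + 4) / 8          ≡⟨ cong (_/ 8) (ℕₚ.+-assoc p 1 3) ⟨
    (p + 1 + 3) / 8      ≡⟨ cong (λ q → (q + 3) / 8) 8m≡p+1 ⟨
    (8 * m + 3) / 8      ≡⟨ cong (_/ 8) (trans (ℕₚ.+-comm (8 * m) 3) (cong (λ q → 3 + q) (ℕₚ.*-comm 8 m))) ⟩
    (3 + m * 8) / 8      ≡⟨ [k+m*8]/8≡m m 3 (s≤s (s≤s (s≤s (s≤s z≤n)))) ⟩
    m                    ∎))
    where
    open ≡-Reasoning
    8m≡p+1 : 8 * m ≡ p + 1
    8m≡p+1 = ℤₚ.+-injective (begin
      + (8 * m)                         ≡⟨ ℤₚ.pos-* 8 m ⟩
      + 8 ℤ.* + m                       ≡⟨ add-back (+ 8 ℤ.* + m) ⟩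
      + 8 ℤ.* + m ℤ.+ -1ℤ ℤ.+ 1ℤ        ≡⟨ cong (ℤ._+ 1ℤ) 8m-1≡p ⟩
      + p ℤ.+ 1ℤ                        ∎)
      where
      add-back : ∀ x → x ≡ x ℤ.+ -1ℤ ℤ.+ 1ℤ
      add-back = ℤ-Solver.solve-∀

  8m+[2+8k]≡p+p⇒p%4≡1 : ∀ m k p → 8 * m + (2 + k * 8) ≡ p + p → p % 4 ≡ 1
  8m+[2+8k]≡p+p⇒p%4≡1 m k p 8m+2+8k≡p+p = begin
    p % 4                    ≡⟨ cong (_% 4) (ℕₚ.*-cancelˡ-≡ p (1 + (m + k) * 4) 2 2p≡2[1+4[m+k]]) ⟩
    (1 + (m + k) * 4) % 4    ≡⟨ [m+kn]%n≡m%n 1 (m + k) 4 ⟩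
    1                        ∎
    where
    open ≡-Reasoning
    double : ∀ p → 2 * p ≡ p + p
    double = ℕ-Solver.solve-∀
    halve : ∀ m k → 8 * m + (2 + k * 8) ≡ 2 * (1 + (m + k) * 4)
    halve = ℕ-Solver.solve-∀
    2p≡2[1+4[m+k]] : 2 * p ≡ 2 * (1 + (m + k) * 4)
    2p≡2[1+4[m+k]] = trans (double p) (trans (sym 8m+2+8k≡p+p) (halve m k))

module PrimeThreeModFour (p : ℕ) .{{_ : NonZero p}} (p-prime : Prime p) (p%4≡3 : p % 4 ≡ 3) where
  open import Data.Integer.Base using (+_; _+_; _*_)
  open EighthsArithmetic

  3≤p : 3 ℕ.≤ p
  3≤p = subst (ℕ._≤ p) p%4≡3 (m%n≤m p 4)

  open PatternCount p p-prime 3≤p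

  neg1≉0 : neg 1 ≉ 0
  neg1≉0 neg1≈0 = 1≉0 (≈-trans (≈-sym (+-congˡ 1 neg1≈0)) (+-inverseʳ 1))

  private
    N₁ N₂ : ℕ
    N₁ = occurrences p (Letter.r ∷ Letter.r ∷ Letter.r ∷ [])
    N₂ = occurrences p (Letter.r ∷ Letter.r ∷ Letter.n ∷ [])
    D₁ D₂ : ℤ
    D₁ = defect 1ℤ 1ℤ 1ℤ (χ (neg 1)) (χ 2)
    D₂ = defect 1ℤ 1ℤ -1ℤ (χ (neg 1)) (χ 2)

  -- The patterns rrr and rrn carry opposite signs in front of the triple character sum.
  8N₁+8N₂+D₁+D₂≡2p : + 8 * + (N₁ ℕ.+ N₂) + (D₁ + D₂) ≡ + p + + p
  8N₁+8N₂+D₁+D₂≡2p = begin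
    + 8 * (+ N₁ + + N₂) + (D₁ + D₂)       ≡⟨ regroup (+ N₁) (+ N₂) D₁ D₂ ⟩
    + 8 * + N₁ + D₁ + (+ 8 * + N₂ + D₂)   ≡⟨ cong₂ _+_ (eight-occurrences Letter.r Letter.r Letter.r) (eight-occurrences Letter.r Letter.r Letter.n) ⟩
    + p + 1ℤ * X + (+ p + -1ℤ * X)       ≡⟨ cancel (+ p) X ⟩
    + p + + p                            ∎
    where
    open ≡-Reasoning
    X = ∑ (λ x → χ x * χ (x ℕ.+ 1) * χ (x ℕ.+ 2))
    regroup : ∀ n₁ n₂ d₁ d₂ → + 8 * (n₁ + n₂) + (d₁ + d₂) ≡ + 8 * n₁ + d₁ + (+ 8 * n₂ + d₂)
    regroup = ℤ-Solver.solve-∀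
    cancel : ∀ P X → P + 1ℤ * X + (P + -1ℤ * X) ≡ P + P
    cancel = ℤ-Solver.solve-∀

  D₁+D₂≡2+8k : χ (neg 1) ≡ 1ℤ → Σ ℕ λ k → D₁ + D₂ ≡ + (2 ℕ.+ k ℕ.* 8)
  D₁+D₂≡2+8k χ[-1]≡1 with χ-±1 2≉0
  ... | inj₁ χ[2]≡1  rewrite χ[-1]≡1 | χ[2]≡1  = 2 , refl
  ... | inj₂ χ[2]≡-1 rewrite χ[-1]≡1 | χ[2]≡-1 = 1 , refl

  χ[-1]≡-1 : χ (neg 1) ≡ -1ℤ
  χ[-1]≡-1 with χ-±1 (neg1≉0)
  ... | inj₂ χ[-1]≡-1 = χ[-1]≡-1
  ... | inj₁ χ[-1]≡1 with D₁+D₂≡2+8k χ[-1]≡1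
  ...   | k , D₁+D₂≡2+8k = contradiction (trans (sym p%4≡1) p%4≡3) λ ()
    where
    p%4≡1 : p % 4 ≡ 1
    p%4≡1 = 8m+[2+8k]≡p+p⇒p%4≡1 (N₁ ℕ.+ N₂) k p (ℤₚ.+-injective (begin
      + (8 ℕ.* (N₁ ℕ.+ N₂) ℕ.+ (2 ℕ.+ k ℕ.* 8))  ≡⟨ 8*+k≡+ (N₁ ℕ.+ N₂) (2 ℕ.+ k ℕ.* 8) ⟨
      + 8 * + (N₁ ℕ.+ N₂) + + (2 ℕ.+ k ℕ.* 8)   ≡⟨ cong (λ d → + 8 * + (N₁ ℕ.+ N₂) + d) D₁+D₂≡2+8k ⟨
      + 8 * + (N₁ ℕ.+ N₂) + (D₁ + D₂)           ≡⟨ 8N₁+8N₂+D₁+D₂≡2p ⟩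
      + p + + p                                 ∎))
      where open ≡-Reasoning

  occurrences-floor-or-ceil : ∀ l₀ l₁ l₂ → let N = occurrences p (l₀ ∷ l₁ ∷ l₂ ∷ []) in
                              N ≡ (p ℕ.∸ 3) / 8 ⊎ N ≡ (p ℕ.∸ 3 ℕ.+ 7) / 8
  occurrences-floor-or-ceil l₀ l₁ l₂ = floor-or-ceil 3≤p 8N+d≡p (defect-values l₀ l₁ l₂ (χ-±1 2≉0))
    where
    open ≡-Reasoning
    N = occurrences p (l₀ ∷ l₁ ∷ l₂ ∷ [])
    abc = sign l₀ * sign l₁ * sign l₂
    8N+d≡p : + 8 * + N + defect (sign l₀) (sign l₁) (sign l₂) -1ℤ (χ 2) ≡ + p
    8N+d≡p = begin
      + 8 * + N + defect (sign l₀) (sign l₁) (sign l₂) -1ℤ (χ 2)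
        ≡⟨ cong (λ t → + 8 * + N + defect (sign l₀) (sign l₁) (sign l₂) t (χ 2)) χ[-1]≡-1 ⟨
      + 8 * + N + defect (sign l₀) (sign l₁) (sign l₂) (χ (neg 1)) (χ 2)
        ≡⟨ eight-occurrences l₀ l₁ l₂ ⟩
      + p + abc * ∑ (λ x → χ x * χ (x ℕ.+ 1) * χ (x ℕ.+ 2))
        ≡⟨ cong (λ X → + p + abc * X) (∑χχχ≡0 χ[-1]≡-1) ⟩
      + p + abc * 0ℤ
        ≡⟨ trans (cong (λ y → + p + y) (ℤₚ.*-zeroʳ abc)) (ℤₚ.+-identityʳ (+ p)) ⟩
      + p ∎

corollary2p5 : (p : ℕ) .{{_ : NonZero p}} → Prime p → p % 4 ≡ 3 →
    (w : Pattern 3) →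
    (occurrences p w ≡ (p ℕ.∸ 3) / 8) ⊎ (occurrences p w ≡ (p ℕ.∸ 3 ℕ.+ 7) / 8)
corollary2p5 p p-prime p%4≡3 (l₀ ∷ l₁ ∷ l₂ ∷ []) =
  PrimeThreeModFour.occurrences-floor-or-ceil p p-prime p%4≡3 l₀ l₁ l₂
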